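{- For all $n\ge1$, \[a_{\{0102,0112,0120\}}(n)=a_{\{0102,0112,0121\}}(n)=a_{\{0112,0120,0121\}}(n)=2^{n-1}+\binom{n}{3}.\]
   Context: An ascent in an integer sequence $s_1\cdots s_m$ is an index $j$ with $s_j<s_{j+1}$; $\mathrm{asc}(s)$ is the number of ascents. An ascent sequence is a sequence $x_1\cdots x_n$ of nonnegative integers with $x_1=0$ and $x_i\le 1+\mathrm{asc}(x_1\cdots x_{i-1})$ for $i\ge2$. For a sequence $w$, $\mathrm{red}(w)$ replaces the $i$-th smallest distinct letter of $w$ by $i-1$. A pattern (e.g. $0102$, meaning the sequence $(0,1,0,2)$) is a sequence equal to its reduction. A sequence $x$ contains pattern $p=p_1\cdots p_k$ if there are indices $i_1<\cdots<i_k$ with $\mathrm{red}(x_{i_1}\cdots x_{i_k})=p$; otherwise it avoids $p$. For a set of patterns $P$, $\mathcal A_n(P)$ is the set of ascent sequences of length $n$ avoiding every pattern in $P$, and $a_P(n)=|\mathcal A_n(P)|$. -}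

module Defs where

open import Data.Bool using (Bool; true; false; _∧_; not; if_then_else_; T)
open import Data.Nat using (ℕ; zero; suc; _+_; _<ᵇ_; _≤ᵇ_; _≟_; _<?_)
open import Data.List using (List; []; _∷_; length; map; filter; take; drop; upTo; deduplicate; head)
open import Data.Bool.ListAction using (all; any)
open import Data.List.Properties using (≡-dec)
open import Data.Maybe using (Maybe; just; nothing)
open import Data.Product using (Σ; _×_)
open import Relation.Nullary.Decidable using (⌊_⌋)
open import Relation.Binary.PropositionalEquality using (_≡_)

asc : List ℕ → ℕ
asc (a ∷ b ∷ s) = (if a <ᵇ b then 1 else 0) + asc (b ∷ s)
asc _ = 0

-- i-th entry (0-based) compared against a bound; a missing entry counts as false
entry≤ : List ℕ → ℕ → ℕ → Bool
entry≤ x i bound with head (drop i x)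
... | just v  = v ≤ᵇ bound
... | nothing = false

-- ascent sequence: x_1 = 0 and x_i ≤ 1 + asc(x_1 ⋯ x_{i-1}) for i ≥ 2
-- (0-based index i ≥ 1: prefix x_0 ⋯ x_{i-1} is  take i x)
isAscentSeq : List ℕ → Bool
isAscentSeq [] = true
isAscentSeq (x₀ ∷ xs) =
  (x₀ ≤ᵇ 0) ∧ all (λ j → entry≤ (x₀ ∷ xs) (suc j) (suc (asc (take (suc j) (x₀ ∷ xs))))) (upTo (length xs))

red : List ℕ → List ℕ
red w = map (λ v → length (filter (_<? v) (deduplicate _≟_ w))) w

subseqs : List ℕ → List (List ℕ)
subseqs [] = [] ∷ []
subseqs (a ∷ s) = map (a ∷_) (subseqs s) Data.List.++ subseqs s

contains : List ℕ → List ℕ → Bool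
contains x p = any (λ s → ⌊ ≡-dec _≟_ (red s) p ⌋) (subseqs x)

avoidsAll : List (List ℕ) → List ℕ → Bool
avoidsAll P x = all (λ p → not (contains x p)) P

𝒜 : ℕ → List (List ℕ) → Set
𝒜 n P = Σ (List ℕ) (λ x → (length x ≡ n) × T (isAscentSeq x ∧ avoidsAll P x))

p0102 p0112 p0120 p0121 : List ℕ
p0102 = 0 ∷ 1 ∷ 0 ∷ 2 ∷ []
p0112 = 0 ∷ 1 ∷ 1 ∷ 2 ∷ []
p0120 = 0 ∷ 1 ∷ 2 ∷ 0 ∷ []
p0121 = 0 ∷ 1 ∷ 2 ∷ 1 ∷ []

-- An ascent sequence avoiding one of the three pattern sets is read letter by letter by an
-- automaton that remembers only the shape of the prefix read so far: a block of zeros, then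
-- after the first 1 either a binary sequence, or a staircase 0 1 2 ⋯ k followed by a plateau
-- k ⋯ k and a constant tail (of k − 1 for {0102, 0112, 0120}, of 0 for {0102, 0112, 0121};
-- for {0112, 0120, 0121} the 1 may be followed by zeros and there is no tail). A letter may
-- be appended exactly when it respects the ascent bound and is not the last letter of a new
-- occurrence of a forbidden pattern; invariants on the prefix attached to each state decide
-- this. Counting the runs of length n − 1 gives the 2^(n−1) binary sequences plus the C(n, 3)
-- ways to choose the lengths of the four blocks of a non-binary avoider.

module Submission where

open import Defs
open import Data.Bool using (Bool; T; true; false; _∧_; not; if_then_else_)
open import Data.Bool.ListAction using (all)
open import Data.Bool.Properties using (∧-assoc; ∧-identityʳ; T-∧; T-irrelevant)
open import Data.Empty using (⊥-elim)
open import Data.Fin using (Fin)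
import Data.Fin as Fin
open import Data.Maybe using (just; nothing; maybe′)
open import Data.Nat using (ℕ; zero; suc; _+_; _∸_; _^_; _<_; _≤_; _≟_; _<?_; _<ᵇ_; _≤ᵇ_; z≤n; s≤s; pred)
open import Data.Nat.Properties
  using (≤-refl; ≤-trans; <-trans; <-≤-trans; ≤-<-trans; <-irrefl; <-asym; <-cmp; <⇒≤; <⇒≱; <⇒≢; ≤⇒≯; ≮⇒≥
        ; n≤1+n; n<1+n; m≤n⇒m≤1+n; m<n⇒m<1+n; m≤n⇒m<n∨m≡n; m≤n+m; n≮0; n≤0⇒n≡0
        ; +-assoc; +-comm; +-identityʳ; +-monoˡ-<; <⇒<ᵇ; <ᵇ⇒<; ≤ᵇ⇒≤; ≤⇒≤ᵇ; suc-injective)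
open import Data.Nat.Combinatorics using (_C_; nCk+nC[k+1]≡[n+1]C[k+1]; nC1≡n)
open import Data.Nat.ListAction using (sum)
open import Data.Nat.Tactic.RingSolver using (solve-∀)
open import Data.List using (List; []; _∷_; _++_; length; map; filter; deduplicate; reverse; take; drop; head; upTo; downFrom; lookup)
open import Data.List.Properties
  using (map-∘; map-cong; map-cong-local; map-id; length-map; length-++; ++-assoc; filter-accept; filter-reject
        ; filter-≐; reverse-map; reverse-involutive; unfold-reverse; upTo-∷ʳ; take-all; ∷-injectiveˡ; ∷-injectiveʳ)
open import Data.List.Membership.Propositional using (_∈_; find; lose)
open import Data.List.Membership.Propositional.Properties using (∈-map⁻; ∈-map⁺; ∈-++⁺ˡ; ∈-++⁺ʳ; ∈-++⁻; ∈-deduplicate⁺; ∈-lookup)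
import Data.List.Membership.Setoid.Properties as SetoidMembership
open import Data.List.Relation.Unary.All as All using (All; []; _∷_)
open import Data.List.Relation.Unary.All.Properties using () renaming (map⁻ to All-map⁻)
open import Data.List.Relation.Unary.Any using (here; there; index)
open import Data.List.Relation.Unary.Any.Properties using (any⁺; any⁻; lookup-index) renaming (reverse⁺ to Any-reverse⁺)
open import Data.List.Relation.Unary.Unique.Propositional using (Unique; []; _∷_)
import Data.List.Relation.Unary.Unique.Propositional.Properties as Unique
open import Data.List.Relation.Binary.Sublist.Propositional using (_⊆_; []; _∷_; _∷ʳ_; ⊆-refl; ⊆-trans; minimum) renaming (lookup to ⊆-lookup)
open import Data.List.Relation.Binary.Sublist.Propositional.Properties using (filter⁺; length-mono-≤; reverse⁺; reverse⁻; All-resp-⊆)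
open import Data.Product using (Σ; ∃-syntax; _×_; _,_; proj₁; proj₂; uncurry)
open import Data.Product.Function.NonDependent.Propositional using (_×-⇔_)
open import Data.Sum using (_⊎_; inj₁; inj₂)
open import Data.Unit using (⊤; tt)
open import Function using (_∘_; const; _⇔_; mk⇔; Equivalence; _↔_; mk↔ₛ′)
open import Function.Construct.Composition using (_⇔-∘_)
open import Function.Related.Propositional using (≡⇒)
open import Function.Related.TypeIsomorphisms using (¬-cong-⇔)
open import Relation.Binary.Core using (_Preserves_⟶_)
open import Relation.Binary.Definitions using (tri<; tri≈; tri>)
open import Relation.Binary.PropositionalEquality using (_≡_; _≢_; refl; sym; trans; cong; cong₂; subst; subst₂; setoid; module ≡-Reasoning)
open import Relation.Binary.PropositionalEquality.WithK using (≡-irrelevant)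
open import Relation.Nullary using (¬_; Irrelevant; does; ¬?; yes; no; contradiction)
open import Relation.Nullary.Decidable using (toWitness; fromWitness)
open import Relation.Unary using (Pred; Decidable)

-- Containment of a pattern as a substitution instance

filter-map : ∀ {ℓ} {A B : Set} {P : Pred B ℓ} (P? : Decidable P) (f : A → B) xs →
             filter P? (map f xs) ≡ map f (filter (P? ∘ f) xs)
filter-map P? f [] = refl
filter-map P? f (x ∷ xs) with does (P? (f x))
... | true = cong (f x ∷_) (filter-map P? f xs)
... | false = filter-map P? f xs

∈-subseqs⁺ : ∀ {s x} → s ⊆ x → s ∈ subseqs x
∈-subseqs⁺ [] = here refl
∈-subseqs⁺ (_∷ʳ_ {ys = x} y s⊆x) = ∈-++⁺ʳ (map (y ∷_) (subseqs x)) (∈-subseqs⁺ s⊆x)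
∈-subseqs⁺ (refl ∷ s⊆x) = ∈-++⁺ˡ (∈-map⁺ _ (∈-subseqs⁺ s⊆x))

∈-subseqs⁻ : ∀ {s} x → s ∈ subseqs x → s ⊆ x
∈-subseqs⁻ [] (here refl) = []
∈-subseqs⁻ (y ∷ x) s∈ with ∈-++⁻ (map (y ∷_) (subseqs x)) s∈
... | inj₁ s∈map with _ , s′∈ , refl ← ∈-map⁻ (y ∷_) s∈map = refl ∷ ∈-subseqs⁻ x s′∈
... | inj₂ s∈rest = y ∷ʳ ∈-subseqs⁻ x s∈rest

contains⁺ : ∀ {s x} → s ⊆ x → T (contains x (red s))
contains⁺ s⊆x = any⁺ _ (lose (∈-subseqs⁺ s⊆x) (fromWitness refl))

contains⁻ : ∀ x p → T (contains x p) → ∃[ s ] s ⊆ x × red s ≡ p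
contains⁻ x p t with s , s∈ , eq ← find (any⁻ _ (subseqs x) t) = s , ∈-subseqs⁻ x s∈ , toWitness eq

countBelow : ℕ → List ℕ → ℕ
countBelow v D = length (filter (_<? v) D)

countBelow-mono : ∀ {v u D E} → v ≤ u → D ⊆ E → countBelow v D ≤ countBelow u E
countBelow-mono {v} {u} v≤u D⊆E = length-mono-≤ (filter⁺ (_<? v) (_<? u) below D⊆E)
  where
  below : ∀ {y z} → y ≡ z → y < v → z < u
  below refl y<v = <-≤-trans y<v v≤u

countBelow-strict : ∀ {x u D} → x ∈ D → x < u → countBelow x D < countBelow u D
countBelow-strict {x} {u} {_ ∷ D} (here refl) x<u
  rewrite filter-reject (_<? x) {xs = D} (<-irrefl refl) | filter-accept (_<? u) {xs = D} x<u
  = s≤s (countBelow-mono {D = D} (<⇒≤ x<u) ⊆-refl)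
countBelow-strict {x} {u} {y ∷ D} (there x∈D) x<u with y <? x
... | yes y<x rewrite filter-accept (_<? x) {xs = D} y<x | filter-accept (_<? u) {xs = D} (<-trans y<x x<u)
  = s≤s (countBelow-strict x∈D x<u)
... | no y≮x rewrite filter-reject (_<? x) {xs = D} y≮x
  = <-≤-trans (countBelow-strict x∈D x<u) (countBelow-mono {u} {D = D} ≤-refl (y ∷ʳ ⊆-refl))

rank : List ℕ → ℕ → ℕ
rank s v = countBelow v (deduplicate _≟_ s)

rank-<⁻ : ∀ s {x y} → rank s x < rank s y → x < y
rank-<⁻ s {x} {y} r< with x <? y
... | yes x<y = x<y
... | no x≮y = contradiction (countBelow-mono {D = deduplicate _≟_ s} (≮⇒≥ x≮y) ⊆-refl) (<⇒≱ r<)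

rank-injective : ∀ {s x y} → x ∈ s → y ∈ s → rank s x ≡ rank s y → x ≡ y
rank-injective {s} {x} {y} x∈s y∈s eq with <-cmp x y
... | tri< x<y _ _ = contradiction eq (<⇒≢ (countBelow-strict (∈-deduplicate⁺ _≟_ x∈s) x<y))
... | tri≈ _ x≡y _ = x≡y
... | tri> _ _ y<x = contradiction (sym eq) (<⇒≢ (countBelow-strict (∈-deduplicate⁺ _≟_ y∈s) y<x))

module StrictlyMonotone {f : ℕ → ℕ} (f-mono : f Preserves _<_ ⟶ _<_) where

  reflects-< : ∀ {x y} → f x < f y → x < y
  reflects-< {x} {y} fx<fy with <-cmp x y
  ... | tri< x<y _ _ = x<y
  ... | tri≈ _ refl _ = contradiction fx<fy (<-irrefl refl)
  ... | tri> _ _ y<x = contradiction fx<fy (<-asym (f-mono y<x))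

  injective : ∀ {x y} → f x ≡ f y → x ≡ y
  injective {x} {y} fx≡fy with <-cmp x y
  ... | tri< x<y _ _ = contradiction fx≡fy (<⇒≢ (f-mono x<y))
  ... | tri≈ _ x≡y _ = x≡y
  ... | tri> _ _ y<x = contradiction (sym fx≡fy) (<⇒≢ (f-mono y<x))

  deduplicate-map : ∀ xs → deduplicate _≟_ (map f xs) ≡ map f (deduplicate _≟_ xs)
  deduplicate-map [] = refl
  deduplicate-map (x ∷ xs) = cong (f x ∷_) (begin
    filter (¬? ∘ (f x ≟_)) (deduplicate _≟_ (map f xs))   ≡⟨ cong (filter (¬? ∘ (f x ≟_))) (deduplicate-map xs) ⟩
    filter (¬? ∘ (f x ≟_)) (map f (deduplicate _≟_ xs))   ≡⟨ filter-map (¬? ∘ (f x ≟_)) f (deduplicate _≟_ xs) ⟩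
    map f (filter (¬? ∘ (f x ≟_) ∘ f) (deduplicate _≟_ xs))
      ≡⟨ cong (map f) (filter-≐ _ _ (fx≢⇒x≢ , x≢⇒fx≢) (deduplicate _≟_ xs)) ⟩
    map f (filter (¬? ∘ (x ≟_)) (deduplicate _≟_ xs))     ∎)
    where
    open ≡-Reasoning
    fx≢⇒x≢ : ∀ {y} → ¬ f x ≡ f y → ¬ x ≡ y
    fx≢⇒x≢ ne e = ne (cong f e)
    x≢⇒fx≢ : ∀ {y} → ¬ x ≡ y → ¬ f x ≡ f y
    x≢⇒fx≢ ne e = ne (injective e)

  countBelow-map : ∀ v D → countBelow (f v) (map f D) ≡ countBelow v D
  countBelow-map v D = begin
    length (filter (_<? f v) (map f D))         ≡⟨ cong length (filter-map (_<? f v) f D) ⟩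
    length (map f (filter ((_<? f v) ∘ f) D))   ≡⟨ length-map f (filter ((_<? f v) ∘ f) D) ⟩
    length (filter ((_<? f v) ∘ f) D)           ≡⟨ cong length (filter-≐ _ _ (reflects-< , f-mono) D) ⟩
    length (filter (_<? v) D)                   ∎
    where open ≡-Reasoning

  red-map : ∀ s → red (map f s) ≡ red s
  red-map s = begin
    map (rank (map f s)) (map f s)
      ≡⟨ cong (λ D → map (λ v → countBelow v D) (map f s)) (deduplicate-map s) ⟩
    map (λ v → countBelow v (map f (deduplicate _≟_ s))) (map f s)
      ≡⟨ sym (map-∘ s) ⟩
    map (λ v → countBelow (f v) (map f (deduplicate _≟_ s))) s
      ≡⟨ map-cong (λ v → countBelow-map v (deduplicate _≟_ s)) s ⟩
    map (rank s) s ∎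
    where open ≡-Reasoning

-- Letters above 2 are shifted past c only so that letter a b c is strictly monotone.
letter : ℕ → ℕ → ℕ → ℕ → ℕ
letter a b c 0 = a
letter a b c 1 = b
letter a b c (suc (suc k)) = k + c

letter-mono : ∀ {a b c} → a < b → b < c → letter a b c Preserves _<_ ⟶ _<_
letter-mono a<b b<c {0} {1} _ = a<b
letter-mono a<b b<c {0} {suc (suc y)} _ = <-trans a<b (<-≤-trans b<c (m≤n+m _ y))
letter-mono a<b b<c {1} {suc (suc y)} _ = <-≤-trans b<c (m≤n+m _ y)
letter-mono a<b b<c {suc (suc x)} {suc (suc y)} (s≤s (s≤s x<y)) = +-monoˡ-< _ x<y
letter-mono a<b b<c {1} {1} (s≤s ())

_⟨_,_,_⟩ : List ℕ → ℕ → ℕ → ℕ → List ℕ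
p ⟨ a , b , c ⟩ = map (letter a b c) p

data Occurs (p x : List ℕ) : Set where
  occurs : ∀ {a b c} → a < b → b < c → p ⟨ a , b , c ⟩ ⊆ x → Occurs p x

record ThreeLetterPattern (p : List ℕ) : Set where
  field
    reduced : red p ≡ p
    letters≤2 : All (_≤ 2) p
    has0 : 0 ∈ p
    has1 : 1 ∈ p
    has2 : 2 ∈ p

red-letters : ∀ {s a b c} → a ∈ s → b ∈ s → c ∈ s → 0 ≡ rank s a → 1 ≡ rank s b → 2 ≡ rank s c →
              All (_≤ 2) (red s) → red s ⟨ a , b , c ⟩ ≡ s
red-letters {s} {a} {b} {c} a∈s b∈s c∈s ra rb rc red≤2 = begin
  map (letter a b c) (map (rank s) s)  ≡⟨ sym (map-∘ s) ⟩
  map (letter a b c ∘ rank s) s        ≡⟨ map-cong-local (All.tabulate letter-rank) ⟩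
  map (λ y → y) s                      ≡⟨ map-id s ⟩
  s                                    ∎
  where
  open ≡-Reasoning
  letter-rank : ∀ {y} → y ∈ s → letter a b c (rank s y) ≡ y
  letter-rank {y} y∈s with rank s y in ry | All.lookup (All-map⁻ red≤2) y∈s
  ... | 0 | _ = rank-injective a∈s y∈s (trans (sym ra) (sym ry))
  ... | 1 | _ = rank-injective b∈s y∈s (trans (sym rb) (sym ry))
  ... | 2 | _ = rank-injective c∈s y∈s (trans (sym rc) (sym ry))
  ... | suc (suc (suc _)) | s≤s (s≤s ())

module _ {p} (p-letters : ThreeLetterPattern p) where
  open ThreeLetterPattern p-letters

  contains⇒occurs : ∀ {x} → T (contains x p) → Occurs p x
  contains⇒occurs {x} t with contains⁻ x p t
  ... | s , s⊆x , refl with ∈-map⁻ (rank s) has0 | ∈-map⁻ (rank s) has1 | ∈-map⁻ (rank s) has2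
  ... | a , a∈s , ra | b , b∈s , rb | c , c∈s , rc =
    occurs (rank-<⁻ s (subst₂ _<_ ra rb (s≤s z≤n))) (rank-<⁻ s (subst₂ _<_ rb rc (s≤s (s≤s z≤n))))
      (subst (_⊆ x) (sym (red-letters a∈s b∈s c∈s ra rb rc letters≤2)) s⊆x)

  occurs⇒contains : ∀ {x} → Occurs p x → T (contains x p)
  occurs⇒contains {x} (occurs a<b b<c occ) =
    subst (T ∘ contains x) (trans (StrictlyMonotone.red-map (letter-mono a<b b<c) p) reduced) (contains⁺ occ)

occurs-reverse : ∀ {p x} → Occurs p x ⇔ Occurs (reverse p) (reverse x)
occurs-reverse {p} {x} = mk⇔
  (λ { (occurs {a} {b} {c} a<b b<c occ) →
          occurs a<b b<c (subst (_⊆ reverse x) (sym (reverse-map (letter a b c) p)) (reverse⁺ occ)) })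
  (λ { (occurs {a} {b} {c} a<b b<c occ) →
          occurs a<b b<c (reverse⁻ (subst (_⊆ reverse x) (reverse-map (letter a b c) p) occ)) })

-- Ascent sequences read backwards

-- Prefixes grow by consing, so they are kept reversed: the head of r is the last letter of reverse r.
ascent : ℕ → ℕ → ℕ
ascent u v = if u <ᵇ v then 1 else 0

ascʳ : List ℕ → ℕ
ascʳ (v ∷ u ∷ r) = ascent u v + ascʳ (u ∷ r)
ascʳ _ = 0

IsAscentSeqʳ : List ℕ → Set
IsAscentSeqʳ [] = ⊤
IsAscentSeqʳ (v ∷ []) = v ≡ 0
IsAscentSeqʳ (v ∷ u ∷ r) = IsAscentSeqʳ (u ∷ r) × v ≤ suc (ascʳ (u ∷ r))

asc-∷ʳ : ∀ xs u v → asc (xs ++ u ∷ v ∷ []) ≡ asc (xs ++ u ∷ []) + ascent u v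
asc-∷ʳ [] u v = +-identityʳ (ascent u v)
asc-∷ʳ (x ∷ []) u v = trans (cong (ascent x u +_) (asc-∷ʳ [] u v)) (sym (+-assoc (ascent x u) 0 (ascent u v)))
asc-∷ʳ (x ∷ y ∷ xs) u v = trans (cong (ascent x y +_) (asc-∷ʳ (y ∷ xs) u v)) (sym (+-assoc (ascent x y) _ (ascent u v)))

asc-reverse : ∀ r → asc (reverse r) ≡ ascʳ r
asc-reverse [] = refl
asc-reverse (v ∷ []) = refl
asc-reverse (v ∷ u ∷ r) = begin
  asc (reverse (v ∷ u ∷ r))
    ≡⟨ cong asc (trans (unfold-reverse v (u ∷ r)) (cong (_++ v ∷ []) (unfold-reverse u r))) ⟩
  asc ((reverse r ++ u ∷ []) ++ v ∷ [])  ≡⟨ cong asc (++-assoc (reverse r) (u ∷ []) (v ∷ [])) ⟩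
  asc (reverse r ++ u ∷ v ∷ [])          ≡⟨ asc-∷ʳ (reverse r) u v ⟩
  asc (reverse r ++ u ∷ []) + ascent u v ≡⟨ cong (λ l → asc l + ascent u v) (sym (unfold-reverse u r)) ⟩
  asc (reverse (u ∷ r)) + ascent u v     ≡⟨ cong (_+ ascent u v) (asc-reverse (u ∷ r)) ⟩
  ascʳ (u ∷ r) + ascent u v              ≡⟨ +-comm (ascʳ (u ∷ r)) (ascent u v) ⟩
  ascʳ (v ∷ u ∷ r)                       ∎
  where open ≡-Reasoning

all-++ : ∀ {A : Set} (f : A → Bool) xs ys → all f (xs ++ ys) ≡ all f xs ∧ all f ys
all-++ f [] ys = refl
all-++ f (x ∷ xs) ys = trans (cong (f x ∧_) (all-++ f xs ys)) (sym (∧-assoc (f x) (all f xs) (all f ys)))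

all-upTo-suc : ∀ (f : ℕ → Bool) m → all f (upTo (suc m)) ≡ all f (upTo m) ∧ f m
all-upTo-suc f m = begin
  all f (upTo (suc m))            ≡⟨ cong (all f) (sym (upTo-∷ʳ m)) ⟩
  all f (upTo m ++ m ∷ [])        ≡⟨ all-++ f (upTo m) (m ∷ []) ⟩
  all f (upTo m) ∧ (f m ∧ true)   ≡⟨ cong (all f (upTo m) ∧_) (∧-identityʳ (f m)) ⟩
  all f (upTo m) ∧ f m            ∎
  where open ≡-Reasoning

all-upTo-cong : ∀ (f g : ℕ → Bool) m → (∀ {j} → j < m → f j ≡ g j) → all f (upTo m) ≡ all g (upTo m)
all-upTo-cong f g zero f≗g = refl
all-upTo-cong f g (suc m) f≗g = begin
  all f (upTo (suc m))  ≡⟨ all-upTo-suc f m ⟩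
  all f (upTo m) ∧ f m  ≡⟨ cong₂ _∧_ (all-upTo-cong f g m (f≗g ∘ m<n⇒m<1+n)) (f≗g ≤-refl) ⟩
  all g (upTo m) ∧ g m  ≡⟨ sym (all-upTo-suc g m) ⟩
  all g (upTo (suc m))  ∎
  where open ≡-Reasoning

entry≤-defn : ∀ x i b → entry≤ x i b ≡ maybe′ (_≤ᵇ b) false (head (drop i x))
entry≤-defn x i b with head (drop i x)
... | just v = refl
... | nothing = refl

take-++ˡ : ∀ {A : Set} (xs ys : List A) {n} → n ≤ length xs → take n (xs ++ ys) ≡ take n xs
take-++ˡ xs ys {zero} _ = refl
take-++ˡ (x ∷ xs) ys {suc n} (s≤s n≤) = cong (x ∷_) (take-++ˡ xs ys n≤)

head-drop-++ˡ : ∀ {A : Set} (xs ys : List A) {n} → n < length xs → head (drop n (xs ++ ys)) ≡ head (drop n xs)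
head-drop-++ˡ (x ∷ xs) ys {zero} _ = refl
head-drop-++ˡ (x ∷ xs) ys {suc n} (s≤s n<) = head-drop-++ˡ xs ys n<

drop-length-++ : ∀ {A : Set} (xs ys : List A) → drop (length xs) (xs ++ ys) ≡ ys
drop-length-++ [] ys = refl
drop-length-++ (x ∷ xs) ys = drop-length-++ xs ys

entryBound : List ℕ → ℕ → Bool
entryBound x j = entry≤ x (suc j) (suc (asc (take (suc j) x)))

entryBound-++ : ∀ x₀ xs ys {j} → j < length xs → entryBound (x₀ ∷ xs ++ ys) j ≡ entryBound (x₀ ∷ xs) j
entryBound-++ x₀ xs ys {j} j< = begin
  entryBound (x₀ ∷ xs ++ ys) j
    ≡⟨ entry≤-defn (x₀ ∷ xs ++ ys) (suc j) _ ⟩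
  maybe′ (_≤ᵇ suc (asc (x₀ ∷ take j (xs ++ ys)))) false (head (drop j (xs ++ ys)))
    ≡⟨ cong₂ (λ l h → maybe′ (_≤ᵇ suc (asc (x₀ ∷ l))) false h)
             (take-++ˡ xs ys (<⇒≤ j<)) (head-drop-++ˡ xs ys j<) ⟩
  maybe′ (_≤ᵇ suc (asc (x₀ ∷ take j xs))) false (head (drop j xs))
    ≡⟨ sym (entry≤-defn (x₀ ∷ xs) (suc j) _) ⟩
  entryBound (x₀ ∷ xs) j ∎
  where open ≡-Reasoning

entryBound-last : ∀ x₀ xs v → entryBound (x₀ ∷ xs ++ v ∷ []) (length xs) ≡ (v ≤ᵇ suc (asc (x₀ ∷ xs)))
entryBound-last x₀ xs v = begin
  entryBound (x₀ ∷ xs ++ v ∷ []) (length xs)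
    ≡⟨ entry≤-defn (x₀ ∷ xs ++ v ∷ []) (suc (length xs)) _ ⟩
  maybe′ (_≤ᵇ suc (asc (x₀ ∷ take (length xs) (xs ++ v ∷ [])))) false (head (drop (length xs) (xs ++ v ∷ [])))
    ≡⟨ cong₂ (λ l h → maybe′ (_≤ᵇ suc (asc (x₀ ∷ l))) false h)
             (trans (take-++ˡ xs (v ∷ []) ≤-refl) (take-all (length xs) xs ≤-refl))
             (cong head (drop-length-++ xs (v ∷ []))) ⟩
  (v ≤ᵇ suc (asc (x₀ ∷ xs))) ∎
  where open ≡-Reasoning

isAscentSeq-∷ʳ : ∀ x₀ xs v →
                 isAscentSeq (x₀ ∷ xs ++ v ∷ []) ≡ isAscentSeq (x₀ ∷ xs) ∧ (v ≤ᵇ suc (asc (x₀ ∷ xs)))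
isAscentSeq-∷ʳ x₀ xs v = begin
  (x₀ ≤ᵇ 0) ∧ all (entryBound x) (upTo (length (xs ++ v ∷ [])))
    ≡⟨ cong (λ m → (x₀ ≤ᵇ 0) ∧ all (entryBound x) (upTo m)) (trans (length-++ xs) (+-comm (length xs) 1)) ⟩
  (x₀ ≤ᵇ 0) ∧ all (entryBound x) (upTo (suc (length xs)))
    ≡⟨ cong ((x₀ ≤ᵇ 0) ∧_) (all-upTo-suc (entryBound x) (length xs)) ⟩
  (x₀ ≤ᵇ 0) ∧ (all (entryBound x) (upTo (length xs)) ∧ entryBound x (length xs))
    ≡⟨ cong₂ (λ a b → (x₀ ≤ᵇ 0) ∧ (a ∧ b))
             (all-upTo-cong (entryBound x) (entryBound (x₀ ∷ xs)) (length xs) (entryBound-++ x₀ xs (v ∷ [])))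
             (entryBound-last x₀ xs v) ⟩
  (x₀ ≤ᵇ 0) ∧ (all (entryBound (x₀ ∷ xs)) (upTo (length xs)) ∧ (v ≤ᵇ suc (asc (x₀ ∷ xs))))
    ≡⟨ sym (∧-assoc (x₀ ≤ᵇ 0) _ _) ⟩
  isAscentSeq (x₀ ∷ xs) ∧ (v ≤ᵇ suc (asc (x₀ ∷ xs))) ∎
  where
  open ≡-Reasoning
  x = x₀ ∷ xs ++ v ∷ []

isAscentSeq-∷ʳ-∷ʳ : ∀ l u v →
  isAscentSeq ((l ++ u ∷ []) ++ v ∷ []) ≡ isAscentSeq (l ++ u ∷ []) ∧ (v ≤ᵇ suc (asc (l ++ u ∷ [])))
isAscentSeq-∷ʳ-∷ʳ [] u v = isAscentSeq-∷ʳ u [] v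
isAscentSeq-∷ʳ-∷ʳ (x₀ ∷ l) u v = isAscentSeq-∷ʳ x₀ (l ++ u ∷ []) v

isAscentSeq-reverse-∷ : ∀ v u r →
  isAscentSeq (reverse (v ∷ u ∷ r)) ≡ isAscentSeq (reverse (u ∷ r)) ∧ (v ≤ᵇ suc (ascʳ (u ∷ r)))
isAscentSeq-reverse-∷ v u r = begin
  isAscentSeq (reverse (v ∷ u ∷ r))
    ≡⟨ cong isAscentSeq (trans (unfold-reverse v (u ∷ r)) (cong (_++ v ∷ []) (unfold-reverse u r))) ⟩
  isAscentSeq ((reverse r ++ u ∷ []) ++ v ∷ [])
    ≡⟨ isAscentSeq-∷ʳ-∷ʳ (reverse r) u v ⟩
  isAscentSeq (reverse r ++ u ∷ []) ∧ (v ≤ᵇ suc (asc (reverse r ++ u ∷ [])))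
    ≡⟨ cong (λ l → isAscentSeq l ∧ (v ≤ᵇ suc (asc l))) (sym (unfold-reverse u r)) ⟩
  isAscentSeq (reverse (u ∷ r)) ∧ (v ≤ᵇ suc (asc (reverse (u ∷ r))))
    ≡⟨ cong (λ k → isAscentSeq (reverse (u ∷ r)) ∧ (v ≤ᵇ suc k)) (asc-reverse (u ∷ r)) ⟩
  isAscentSeq (reverse (u ∷ r)) ∧ (v ≤ᵇ suc (ascʳ (u ∷ r))) ∎
  where open ≡-Reasoning

isAscentSeq⇒head≡0 : ∀ v y → T (isAscentSeq (v ∷ y)) → v ≡ 0
isAscentSeq⇒head≡0 v y t = n≤0⇒n≡0 (≤ᵇ⇒≤ v 0 (proj₁ (Equivalence.to T-∧ t)))

T-≤ᵇ : ∀ {m n} → T (m ≤ᵇ n) ⇔ m ≤ n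
T-≤ᵇ {m} {n} = mk⇔ (≤ᵇ⇒≤ m n) ≤⇒≤ᵇ

isAscentSeq-reverse : ∀ r → T (isAscentSeq (reverse r)) ⇔ IsAscentSeqʳ r
isAscentSeq-reverse [] = mk⇔ (λ _ → tt) (λ _ → tt)
isAscentSeq-reverse (v ∷ []) = mk⇔ (isAscentSeq⇒head≡0 v []) (λ { refl → tt })
isAscentSeq-reverse (v ∷ u ∷ r) =
  ((isAscentSeq-reverse (u ∷ r) ×-⇔ T-≤ᵇ) ⇔-∘ T-∧) ⇔-∘ ≡⇒ (cong T (isAscentSeq-reverse-∷ v u r))

-- Counting the words accepted by an automaton

index-∈-lookup : ∀ {A : Set} (xs : List A) i → index (∈-lookup {xs = xs} i) ≡ i
index-∈-lookup (x ∷ xs) Fin.zero = refl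
index-∈-lookup (x ∷ xs) (Fin.suc i) = cong Fin.suc (index-∈-lookup xs i)

enumeration↔ : ∀ {A : Set} {Q : A → Set} (L : List A) → Unique L → (∀ {x} → Irrelevant (Q x)) →
               (∀ {x} → x ∈ L ⇔ Q x) → Fin (length L) ↔ Σ A Q
enumeration↔ {A} {Q} L L-unique Q-irrelevant L⇔Q = mk↔ₛ′ to from to∘from from∘to
  where
  to : Fin (length L) → Σ A Q
  to i = lookup L i , Equivalence.to L⇔Q (∈-lookup i)
  from : Σ A Q → Fin (length L)
  from (_ , q) = index (Equivalence.from L⇔Q q)
  to∘from : ∀ y → to (from y) ≡ y
  to∘from (x , q) = pair-≡ _ q (sym (lookup-index (Equivalence.from L⇔Q q)))
    where
    pair-≡ : ∀ {x x′} (q : Q x) (q′ : Q x′) → x ≡ x′ → (x , q) ≡ (x′ , q′)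
    pair-≡ q q′ refl = cong (_ ,_) (Q-irrelevant q q′)
  from∘to : ∀ i → from (to i) ≡ i
  from∘to i = trans (cong index (SetoidMembership.unique⇒irrelevant (setoid A) ≡-irrelevant L-unique _ (∈-lookup i)))
                    (index-∈-lookup L i)

module Automaton {State : Set} (next : State → List (ℕ × State)) where

  Accepts : State → List ℕ → Set
  Accepts s [] = ⊤
  Accepts s (v ∷ y) = ∃[ s′ ] (v , s′) ∈ next s × Accepts s′ y

  mutual
    words : ℕ → State → List (List ℕ)
    words zero s = [] ∷ []
    words (suc n) s = wordsVia n (next s)

    wordsVia : ℕ → List (ℕ × State) → List (List ℕ)
    wordsVia n [] = []
    wordsVia n ((v , s′) ∷ ts) = map (v ∷_) (words n s′) ++ wordsVia n ts

  count : ℕ → State → ℕ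
  count n s = length (words n s)

  ∈-wordsVia⁻ : ∀ {n y} ts → y ∈ wordsVia n ts →
                ∃[ v ] ∃[ s′ ] ∃[ y′ ] y ≡ v ∷ y′ × (v , s′) ∈ ts × y′ ∈ words n s′
  ∈-wordsVia⁻ {n} ((v , s′) ∷ ts) y∈ with ∈-++⁻ (map (v ∷_) (words n s′)) y∈
  ... | inj₁ y∈map with y′ , y′∈ , refl ← ∈-map⁻ (v ∷_) y∈map = v , s′ , y′ , refl , here refl , y′∈
  ... | inj₂ y∈rest with w , s″ , y′ , refl , step , y′∈ ← ∈-wordsVia⁻ ts y∈rest =
    w , s″ , y′ , refl , there step , y′∈

  ∈-wordsVia⁺ : ∀ {n v s′ y} ts → (v , s′) ∈ ts → y ∈ words n s′ → v ∷ y ∈ wordsVia n ts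
  ∈-wordsVia⁺ _ (here refl) y∈ = ∈-++⁺ˡ (∈-map⁺ _ y∈)
  ∈-wordsVia⁺ {n} ((w , s″) ∷ ts) (there step) y∈ = ∈-++⁺ʳ (map (w ∷_) (words n s″)) (∈-wordsVia⁺ ts step y∈)

  ∈-words⁻ : ∀ n s {y} → y ∈ words n s → length y ≡ n × Accepts s y
  ∈-words⁻ zero s (here refl) = refl , tt
  ∈-words⁻ (suc n) s y∈ with v , s′ , y′ , refl , step , y′∈ ← ∈-wordsVia⁻ (next s) y∈
    with length-y′ , acc ← ∈-words⁻ n s′ y′∈ = cong suc length-y′ , s′ , step , acc

  ∈-words⁺ : ∀ n s {y} → length y ≡ n → Accepts s y → y ∈ words n s
  ∈-words⁺ zero s {[]} refl _ = here refl
  ∈-words⁺ (suc n) s {v ∷ y} refl (s′ , step , acc) = ∈-wordsVia⁺ (next s) step (∈-words⁺ n s′ refl acc)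

  words-unique : (∀ s → Unique (map proj₁ (next s))) → ∀ n s → Unique (words n s)
  words-unique next-unique zero s = [] ∷ []
  words-unique next-unique (suc n) s = wordsVia-unique (next s) (next-unique s)
    where
    wordsVia-unique : ∀ ts → Unique (map proj₁ ts) → Unique (wordsVia n ts)
    wordsVia-unique [] _ = []
    wordsVia-unique ((v , s′) ∷ ts) (v∉ ∷ ts-unique) =
      Unique.++⁺ (Unique.map⁺ ∷-injectiveʳ (words-unique next-unique n s′)) (wordsVia-unique ts ts-unique) disjoint
      where
      disjoint : ∀ {y} → ¬ (y ∈ map (v ∷_) (words n s′) × y ∈ wordsVia n ts)
      disjoint (y∈map , y∈rest) with _ , _ , refl ← ∈-map⁻ (v ∷_) y∈map
                                   | _ , s″ , _ , refl , step , _ ← ∈-wordsVia⁻ ts y∈rest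
        = All.lookup v∉ (∈-map⁺ proj₁ step) refl

  count-suc : ∀ n s → count (suc n) s ≡ sum (map (count n ∘ proj₂) (next s))
  count-suc n s = length-wordsVia (next s)
    where
    length-wordsVia : ∀ ts → length (wordsVia n ts) ≡ sum (map (count n ∘ proj₂) ts)
    length-wordsVia [] = refl
    length-wordsVia ((v , s′) ∷ ts) =
      trans (length-++ (map (v ∷_) (words n s′))) (cong₂ _+_ (length-map (v ∷_) (words n s′)) (length-wordsVia ts))

a<b<c⇒2≤c : ∀ {a b c} → a < b → b < c → 2 ≤ c
a<b<c⇒2≤c a<b b<c = ≤-trans (s≤s (≤-trans (s≤s z≤n) a<b)) b<c

occurs-∷ : ∀ {q v r} → Occurs q r → Occurs q (v ∷ r)
occurs-∷ {v = v} (occurs a<b b<c occ) = occurs a<b b<c (v ∷ʳ occ)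

-- The occurrences of q in v ∷ r that are not occurrences in r: those using the new letter v.
data HeadOccurs (q : List ℕ) (v : ℕ) (r : List ℕ) : Set where
  head-occurs : ∀ {a b c t} → a < b → b < c → q ⟨ a , b , c ⟩ ≡ v ∷ t → t ⊆ r → HeadOccurs q v r

headOccurs⇒occurs : ∀ {q v r} → HeadOccurs q v r → Occurs q (v ∷ r)
headOccurs⇒occurs (head-occurs a<b b<c eq t⊆r) = occurs a<b b<c (subst (_⊆ _) (sym eq) (refl ∷ t⊆r))

⊆-∷⁻ : ∀ {xs : List ℕ} {v r} → xs ⊆ v ∷ r → xs ⊆ r ⊎ ∃[ t ] xs ≡ v ∷ t × t ⊆ r
⊆-∷⁻ (_ ∷ʳ xs⊆r) = inj₁ xs⊆r
⊆-∷⁻ (refl ∷ t⊆r) = inj₂ (_ , refl , t⊆r)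

¬head : ∀ {q v r} → ¬ Occurs q (v ∷ r) → ¬ HeadOccurs q v r
¬head ¬occ = ¬occ ∘ headOccurs⇒occurs

occurs-∷⁻ : ∀ {q v r} → Occurs q (v ∷ r) → Occurs q r ⊎ HeadOccurs q v r
occurs-∷⁻ (occurs a<b b<c occ) with ⊆-∷⁻ occ
... | inj₁ occ′ = inj₁ (occurs a<b b<c occ′)
... | inj₂ (_ , eq , t⊆r) = inj₂ (head-occurs a<b b<c eq t⊆r)

Admissible : List (List ℕ) → List ℕ → Set
Admissible P r = IsAscentSeqʳ r × All (λ p → ¬ Occurs (reverse p) r) P

T-not : ∀ {b} → T (not b) ⇔ (¬ T b)
T-not {true} = mk⇔ (λ ()) (λ ¬t → ¬t tt)
T-not {false} = mk⇔ (λ _ ()) (λ _ → tt)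

avoids⇔ : ∀ {p x} → ThreeLetterPattern p → T (not (contains x p)) ⇔ (¬ Occurs (reverse p) (reverse x))
avoids⇔ {p} {x} p-letters =
  ¬-cong-⇔ (occurs-reverse {p} {x} ⇔-∘ mk⇔ (contains⇒occurs p-letters {x}) (occurs⇒contains p-letters {x})) ⇔-∘ T-not

avoidsAll⇔ : ∀ {P x} → All ThreeLetterPattern P → T (avoidsAll P x) ⇔ All (λ p → ¬ Occurs (reverse p) (reverse x)) P
avoidsAll⇔ [] = mk⇔ (λ _ → []) (λ _ → tt)
avoidsAll⇔ {x = x} (p-letters ∷ P-letters) =
  mk⇔ (uncurry _∷_) All.uncons ⇔-∘ ((avoids⇔ {x = x} p-letters ×-⇔ avoidsAll⇔ {x = x} P-letters) ⇔-∘ T-∧)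

admissible⇔ : ∀ {P} → All ThreeLetterPattern P → ∀ x → T (isAscentSeq x ∧ avoidsAll P x) ⇔ Admissible P (reverse x)
admissible⇔ P-letters x = (ascent⇔ ×-⇔ avoidsAll⇔ {x = x} P-letters) ⇔-∘ T-∧
  where
  ascent⇔ : T (isAscentSeq x) ⇔ IsAscentSeqʳ (reverse x)
  ascent⇔ = subst (λ y → T (isAscentSeq y) ⇔ IsAscentSeqʳ (reverse x)) (reverse-involutive x) (isAscentSeq-reverse (reverse x))

isAscentSeqʳ-tail : ∀ {v r} → IsAscentSeqʳ (v ∷ r) → IsAscentSeqʳ r
isAscentSeqʳ-tail {r = []} _ = tt
isAscentSeqʳ-tail {r = _ ∷ _} (asc , _) = asc

admissible-tail : ∀ {P v r} → Admissible P (v ∷ r) → Admissible P r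
admissible-tail (asc , avoid) = isAscentSeqʳ-tail asc , All.map (_∘ occurs-∷) avoid

admissible-∷ : ∀ {P v h t} → Admissible P (h ∷ t) → v ≤ suc (ascʳ (h ∷ t)) →
               All (λ p → ¬ HeadOccurs (reverse p) v (h ∷ t)) P → Admissible P (v ∷ h ∷ t)
admissible-∷ (asc , avoid) v≤ no-head = (asc , v≤) , All.zipWith new (avoid , no-head)
  where
  new : ∀ {q} → ¬ Occurs q _ × ¬ HeadOccurs q _ _ → ¬ Occurs q _
  new (¬occ , ¬head) occ with occurs-∷⁻ occ
  ... | inj₁ occ′ = ¬occ occ′
  ... | inj₂ head = ¬head head

binary⇒¬occurs : ∀ {p r} → ThreeLetterPattern p → All (_≤ 1) r → ¬ Occurs (reverse p) r
binary⇒¬occurs p-letters r≤1 (occurs {a} {b} {c} a<b b<c occ) = <⇒≱ (a<b<c⇒2≤c a<b b<c) c≤1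
  where
  c≤1 : c ≤ 1
  c≤1 = All.lookup r≤1 (⊆-lookup occ (∈-map⁺ (letter a b c) (Any-reverse⁺ (ThreeLetterPattern.has2 p-letters))))

binary-admissible : ∀ {P r} → All ThreeLetterPattern P → All (_≤ 1) r → IsAscentSeqʳ r → Admissible P r
binary-admissible P-letters r≤1 asc = asc , All.map (λ p-letters → binary⇒¬occurs p-letters r≤1) P-letters

binary-step : ∀ {P v h t} → All ThreeLetterPattern P → v ≤ 1 → All (_≤ 1) (h ∷ t) →
              Admissible P (h ∷ t) → Admissible P (v ∷ h ∷ t)
binary-step P-letters v≤1 r≤1 (asc , _) = binary-admissible P-letters (v≤1 ∷ r≤1) (asc , ≤-trans v≤1 (s≤s z≤n))

reverse-∷-++ : ∀ (v : ℕ) y r → reverse (v ∷ y) ++ r ≡ reverse y ++ v ∷ r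
reverse-∷-++ v y r = trans (cong (_++ r) (unfold-reverse v y)) (++-assoc (reverse y) (v ∷ []) r)

admissible-suffix : ∀ {P} w {r} → Admissible P (w ++ r) → Admissible P r
admissible-suffix [] adm = adm
admissible-suffix (v ∷ w) adm = admissible-suffix w (admissible-tail adm)

-- A prefix always starts with 0, so the invariants see its reversal as h ∷ t.
module Recognition
  {P : List (List ℕ)} (P-letters : All ThreeLetterPattern P)
  {State : Set} (next : State → List (ℕ × State)) (next-unique : ∀ s → Unique (map proj₁ (next s)))
  (Inv : State → ℕ → List ℕ → Set)
  (step-invariant : ∀ {s s′ v h t} → Inv s h t → (v , s′) ∈ next s → Inv s′ v (h ∷ t))
  (step-admissible : ∀ {s s′ v h t} → Inv s h t → Admissible P (h ∷ t) → (v , s′) ∈ next s →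
                     Admissible P (v ∷ h ∷ t))
  (step-complete : ∀ {s v h t} → Inv s h t → Admissible P (v ∷ h ∷ t) → ∃[ s′ ] (v , s′) ∈ next s)
  (s₀ : State) (inv₀ : Inv s₀ 0 [])
  where

  open Automaton next

  accepts⇔ : ∀ y {s h t} → Inv s h t → Admissible P (h ∷ t) → Accepts s y ⇔ Admissible P (reverse y ++ h ∷ t)
  accepts⇔ [] _ adm = mk⇔ (λ _ → adm) (λ _ → tt)
  accepts⇔ (v ∷ y) {s} {h} {t} inv adm = mk⇔ to from
    where
    to : Accepts s (v ∷ y) → Admissible P (reverse (v ∷ y) ++ h ∷ t)
    to (s′ , step , acc) = subst (Admissible P) (sym (reverse-∷-++ v y (h ∷ t)))
      (Equivalence.to (accepts⇔ y (step-invariant inv step) (step-admissible inv adm step)) acc)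
    from : Admissible P (reverse (v ∷ y) ++ h ∷ t) → Accepts s (v ∷ y)
    from adm-vy with adm-y ← subst (Admissible P) (reverse-∷-++ v y (h ∷ t)) adm-vy
      with s′ , step ← step-complete inv (admissible-suffix (reverse y) adm-y) =
      s′ , step , Equivalence.from (accepts⇔ y (step-invariant inv step) (step-admissible inv adm step)) adm-y

  admissible₀ : Admissible P (0 ∷ [])
  admissible₀ = binary-admissible P-letters (z≤n ∷ []) refl

  ∈-accepted⇔ : ∀ n {x} → x ∈ map (0 ∷_) (words n s₀) ⇔ (length x ≡ suc n × T (isAscentSeq x ∧ avoidsAll P x))
  ∈-accepted⇔ n = mk⇔ to from
    where
    to : ∀ {x} → x ∈ map (0 ∷_) (words n s₀) → length x ≡ suc n × T (isAscentSeq x ∧ avoidsAll P x)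
    to x∈ with y , y∈ , refl ← ∈-map⁻ (0 ∷_) x∈ with length-y , acc ← ∈-words⁻ n s₀ y∈ =
      cong suc length-y ,
      Equivalence.from (admissible⇔ P-letters (0 ∷ y))
        (subst (Admissible P) (sym (unfold-reverse 0 y)) (Equivalence.to (accepts⇔ y inv₀ admissible₀) acc))
    from : ∀ {x} → length x ≡ suc n × T (isAscentSeq x ∧ avoidsAll P x) → x ∈ map (0 ∷_) (words n s₀)
    from {v ∷ y} (length-x , ok) with refl ← isAscentSeq⇒head≡0 v y (proj₁ (Equivalence.to T-∧ ok)) =
      ∈-map⁺ (0 ∷_) (∈-words⁺ n s₀ (suc-injective length-x)
        (Equivalence.from (accepts⇔ y inv₀ admissible₀)
          (subst (Admissible P) (unfold-reverse 0 y) (Equivalence.to (admissible⇔ P-letters (0 ∷ y)) ok))))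

  count↔𝒜 : ∀ n → Fin (count n s₀) ↔ 𝒜 (suc n) P
  count↔𝒜 n = subst (λ k → Fin k ↔ 𝒜 (suc n) P) (length-map (0 ∷_) (words n s₀))
    (enumeration↔ (map (0 ∷_) (words n s₀)) (Unique.map⁺ ∷-injectiveʳ (words-unique next-unique n s₀))
                  (λ (p₁ , q₁) (p₂ , q₂) → cong₂ _,_ (≡-irrelevant p₁ p₂) (T-irrelevant q₁ q₂)) (∈-accepted⇔ n))

-- Invariants of reversed prefixes

∷-⊆-downFrom : ∀ {x xs n} → x < n → xs ⊆ downFrom x → x ∷ xs ⊆ downFrom n
∷-⊆-downFrom {n = suc n} (s≤s x≤n) xs⊆ with m≤n⇒m<n∨m≡n x≤n
... | inj₁ x<n = n ∷ʳ ∷-⊆-downFrom x<n xs⊆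
... | inj₂ refl = refl ∷ xs⊆

ba⊆downFrom : ∀ {a b n} → a < b → b < n → b ∷ a ∷ [] ⊆ downFrom n
ba⊆downFrom a<b b<n = ∷-⊆-downFrom b<n (∷-⊆-downFrom a<b (minimum _))

cba⊆downFrom : ∀ {a b c n} → a < b → b < c → c < n → c ∷ b ∷ a ∷ [] ⊆ downFrom n
cba⊆downFrom a<b b<c c<n = ∷-⊆-downFrom c<n (ba⊆downFrom a<b b<c)

head-≤ : ∀ {k x xs r} → All (_≤ k) r → x ∷ xs ⊆ r → x ≤ k
head-≤ r≤k x∷xs⊆r = All.head (All-resp-⊆ x∷xs⊆r r≤k)

Descending : List ℕ → Set
Descending r = ∀ {a b} → a ∷ b ∷ [] ⊆ r → b ≤ a

descending-∷ : ∀ {v r} → All (_≤ v) r → Descending r → Descending (v ∷ r)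
descending-∷ r≤v desc (_ ∷ʳ ab⊆r) = desc ab⊆r
descending-∷ r≤v desc (refl ∷ b⊆r) = head-≤ r≤v b⊆r

OnlyRepeats : (ℕ → Set) → List ℕ → Set
OnlyRepeats Q r = ∀ {b} → b ∷ b ∷ [] ⊆ r → Q b

record Ladder (k : ℕ) (r : List ℕ) : Set where
  field
    ascents : ascʳ r ≡ k
    bounded : All (_≤ k) r
    steps : downFrom (suc k) ⊆ r

open Ladder

ascent-< : ∀ {u v} → u < v → ascent u v ≡ 1
ascent-< {u} {v} u<v with u <ᵇ v | <⇒<ᵇ u<v
... | true | _ = refl

ascent-≥ : ∀ {u v} → v ≤ u → ascent u v ≡ 0
ascent-≥ {u} {v} v≤u with u <ᵇ v in eq
... | false = refl
... | true = contradiction (<ᵇ⇒< u v (subst T (sym eq) tt)) (≤⇒≯ v≤u)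

ladder-climb : ∀ {k h t} → Ladder k (h ∷ t) → Ladder (suc k) (suc k ∷ h ∷ t)
ladder-climb L = record
  { ascents = cong₂ _+_ (ascent-< (s≤s (All.head (bounded L)))) (ascents L)
  ; bounded = ≤-refl ∷ All.map m≤n⇒m≤1+n (bounded L)
  ; steps = refl ∷ steps L
  }

ladder-∷ : ∀ {k v h t} → Ladder k (h ∷ t) → v ≤ h → Ladder k (v ∷ h ∷ t)
ladder-∷ L v≤h = record
  { ascents = cong₂ _+_ (ascent-≥ v≤h) (ascents L)
  ; bounded = ≤-trans v≤h (All.head (bounded L)) ∷ bounded L
  ; steps = _ ∷ʳ steps L
  }

ladder-bound : ∀ {k v r} → Ladder k r → v ≤ suc k → v ≤ suc (ascʳ r)
ladder-bound L v≤ = subst (λ a → _ ≤ suc a) (sym (ascents L)) v≤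

ladder-too-high : ∀ {k v h t} → Ladder k (h ∷ t) → 2 + k ≤ v → ¬ IsAscentSeqʳ (v ∷ h ∷ t)
ladder-too-high L 2+k≤v (_ , v≤) = <⇒≱ 2+k≤v (subst (λ a → _ ≤ suc a) (ascents L) v≤)

record Staircase (k : ℕ) (r : List ℕ) : Set where
  field
    ladder : Ladder k r
    repeats : OnlyRepeats (_≡ 0) r

staircase-climb : ∀ {k h t} → Staircase k (h ∷ t) → Staircase (suc k) (suc k ∷ h ∷ t)
staircase-climb {k} {h} {t} S = record { ladder = ladder-climb ladder ; repeats = repeats′ }
  where
  open Staircase S
  repeats′ : OnlyRepeats (_≡ 0) (suc k ∷ h ∷ t)
  repeats′ (_ ∷ʳ bb⊆r) = repeats bb⊆r
  repeats′ (refl ∷ b⊆r) = contradiction (head-≤ (bounded ladder) b⊆r) (<⇒≱ ≤-refl)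

staircase-0 : ∀ {k h t} → Staircase k (h ∷ t) → Staircase k (0 ∷ h ∷ t)
staircase-0 {k} {h} {t} S = record { ladder = ladder-∷ ladder z≤n ; repeats = repeats′ }
  where
  open Staircase S
  repeats′ : OnlyRepeats (_≡ 0) (0 ∷ h ∷ t)
  repeats′ (_ ∷ʳ bb⊆r) = repeats bb⊆r
  repeats′ (refl ∷ _) = refl

staircase-[0] : Staircase 0 (0 ∷ [])
staircase-[0] = record { ladder = record { ascents = refl ; bounded = z≤n ∷ [] ; steps = refl ∷ [] } ; repeats = no-pair }
  where
  no-pair : OnlyRepeats (_≡ 0) (0 ∷ [])
  no-pair (_ ∷ʳ ())
  no-pair (refl ∷ ())

descending-[x] : ∀ {x} → Descending (x ∷ [])
descending-[x] (_ ∷ʳ ())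
descending-[x] (refl ∷ ())

record Plateau (k : ℕ) (r : List ℕ) : Set where
  field
    ladder : Ladder k r
    repeats : OnlyRepeats (λ b → b ≡ 0 ⊎ b ≡ k) r
    doubled : k ∷ k ∷ pred k ∷ [] ⊆ r

staircase⇒plateau : ∀ {j t} → Staircase (suc j) (suc j ∷ t) → Plateau (suc j) (suc j ∷ suc j ∷ t)
staircase⇒plateau {j} {t} S = record
  { ladder = ladder-∷ ladder ≤-refl
  ; repeats = repeats′
  ; doubled = refl ∷ ⊆-trans (ba⊆downFrom ≤-refl ≤-refl) (steps ladder)
  }
  where
  open Staircase S
  repeats′ : OnlyRepeats (λ b → b ≡ 0 ⊎ b ≡ suc j) (suc j ∷ suc j ∷ t)
  repeats′ (_ ∷ʳ bb⊆r) = inj₁ (repeats bb⊆r)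
  repeats′ (refl ∷ _) = inj₂ refl

plateau-stay : ∀ {k t} → Plateau k (k ∷ t) → Plateau k (k ∷ k ∷ t)
plateau-stay {k} {t} P = record { ladder = ladder-∷ ladder ≤-refl ; repeats = repeats′ ; doubled = k ∷ʳ doubled }
  where
  open Plateau P
  repeats′ : OnlyRepeats (λ b → b ≡ 0 ⊎ b ≡ k) (k ∷ k ∷ t)
  repeats′ (_ ∷ʳ bb⊆r) = repeats bb⊆r
  repeats′ (refl ∷ _) = inj₂ refl

-- tops-aba and tops-bba keep an appended 1 + m from completing 0102 or 0112.
record Descent (m : ℕ) (r : List ℕ) : Set where
  field
    ladder : Ladder (2 + m) r
    tops-aba : ∀ {a b} → a < b → a ∷ b ∷ a ∷ [] ⊆ r → 1 + m ≤ b
    tops-bba : ∀ {a b} → a < b → b ∷ b ∷ a ∷ [] ⊆ r → 1 + m ≤ b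
    peak : 1 + m ∷ 2 + m ∷ 1 + m ∷ [] ⊆ r
    doubled : 1 + m ∷ 1 + m ∷ m ∷ [] ⊆ r

xy⊆xyz : ∀ {x y z : ℕ} → x ∷ y ∷ [] ⊆ x ∷ y ∷ z ∷ []
xy⊆xyz = refl ∷ refl ∷ _ ∷ʳ []

descent-start : ∀ {m t} → Ladder (2 + m) (2 + m ∷ t) → Descending (2 + m ∷ t) →
                OnlyRepeats (λ b → b ≡ 0 ⊎ b ≡ 2 + m) (2 + m ∷ t) → Descent m (1 + m ∷ 2 + m ∷ t)
descent-start {m} {t} L desc repeats = record
  { ladder = ladder-∷ L (n≤1+n _)
  ; tops-aba = tops-aba
  ; tops-bba = tops-bba
  ; peak = refl ∷ ⊆-trans (ba⊆downFrom ≤-refl ≤-refl) (steps L)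
  ; doubled = refl ∷ ⊆-trans (ba⊆downFrom ≤-refl (n≤1+n _)) (steps L)
  }
  where
  r = 2 + m ∷ t
  tops-aba : ∀ {a b} → a < b → a ∷ b ∷ a ∷ [] ⊆ 1 + m ∷ r → 1 + m ≤ b
  tops-aba a<b (_ ∷ʳ aba⊆r) = contradiction (desc (⊆-trans xy⊆xyz aba⊆r)) (<⇒≱ a<b)
  tops-aba a<b (refl ∷ _) = <⇒≤ a<b
  tops-bba : ∀ {a b} → a < b → b ∷ b ∷ a ∷ [] ⊆ 1 + m ∷ r → 1 + m ≤ b
  tops-bba a<b (_ ∷ʳ bba⊆r) with repeats (⊆-trans xy⊆xyz bba⊆r)
  ... | inj₁ refl = contradiction a<b n≮0
  ... | inj₂ refl = n≤1+n _
  tops-bba a<b (refl ∷ _) = ≤-refl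

descent-stay : ∀ {m t} → Descent m (1 + m ∷ t) → Descent m (1 + m ∷ 1 + m ∷ t)
descent-stay {m} {t} D = record
  { ladder = ladder-∷ ladder ≤-refl
  ; tops-aba = tops-aba′
  ; tops-bba = tops-bba′
  ; peak = _ ∷ʳ peak
  ; doubled = _ ∷ʳ doubled
  }
  where
  open Descent D
  tops-aba′ : ∀ {a b} → a < b → a ∷ b ∷ a ∷ [] ⊆ 1 + m ∷ 1 + m ∷ t → 1 + m ≤ b
  tops-aba′ a<b (_ ∷ʳ aba⊆r) = tops-aba a<b aba⊆r
  tops-aba′ a<b (refl ∷ _) = <⇒≤ a<b
  tops-bba′ : ∀ {a b} → a < b → b ∷ b ∷ a ∷ [] ⊆ 1 + m ∷ 1 + m ∷ t → 1 + m ≤ b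
  tops-bba′ a<b (_ ∷ʳ bba⊆r) = tops-bba a<b bba⊆r
  tops-bba′ a<b (refl ∷ _) = ≤-refl

aba⇒head0102 : ∀ {a b v r} → a < b → b < v → a ∷ b ∷ a ∷ [] ⊆ r → HeadOccurs (reverse p0102) v r
aba⇒head0102 a<b b<v aba⊆r = head-occurs a<b b<v refl aba⊆r

bba⇒head0112 : ∀ {a b v r} → a < b → b < v → b ∷ b ∷ a ∷ [] ⊆ r → HeadOccurs (reverse p0112) v r
bba⇒head0112 a<b b<v bba⊆r = head-occurs a<b b<v refl bba⊆r

cba⇒head0120 : ∀ {a b c r} → a < b → b < c → c ∷ b ∷ a ∷ [] ⊆ r → HeadOccurs (reverse p0120) a r
cba⇒head0120 a<b b<c cba⊆r = head-occurs a<b b<c refl cba⊆r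

cba⇒head0121 : ∀ {a b c r} → a < b → b < c → c ∷ b ∷ a ∷ [] ⊆ r → HeadOccurs (reverse p0121) b r
cba⇒head0121 a<b b<c cba⊆r = head-occurs a<b b<c refl cba⊆r

¬head-0 : ∀ {l q r} → ¬ HeadOccurs (suc l ∷ q) 0 r
¬head-0 {l} (head-occurs a<b b<c eq _) =
  <⇒≢ (≤-<-trans z≤n (letter-mono a<b b<c {0} {suc l} (s≤s z≤n))) (sym (∷-injectiveˡ eq))

descending⇒¬head0102 : ∀ {v r} → Descending r → ¬ HeadOccurs (reverse p0102) v r
descending⇒¬head0102 desc (head-occurs a<b b<c refl aba⊆r) = <⇒≱ a<b (desc (⊆-trans xy⊆xyz aba⊆r))

repeats0⇒¬head0112 : ∀ {v r} → OnlyRepeats (_≡ 0) r → ¬ HeadOccurs (reverse p0112) v r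
repeats0⇒¬head0112 repeats (head-occurs a<b b<c refl bba⊆r) with repeats (⊆-trans xy⊆xyz bba⊆r)
... | refl = n≮0 a<b

plateau⇒¬head0112 : ∀ {k v r} → OnlyRepeats (λ b → b ≡ 0 ⊎ b ≡ k) r → v ≤ k → ¬ HeadOccurs (reverse p0112) v r
plateau⇒¬head0112 repeats v≤k (head-occurs a<b b<c refl bba⊆r) with repeats (⊆-trans xy⊆xyz bba⊆r)
... | inj₁ refl = n≮0 a<b
... | inj₂ refl = <⇒≱ b<c v≤k

descent⇒¬head0102 : ∀ {m v r} → Descent m r → v ≤ 1 + m → ¬ HeadOccurs (reverse p0102) v r
descent⇒¬head0102 D v≤ (head-occurs a<b b<c refl aba⊆r) = <⇒≱ b<c (≤-trans v≤ (Descent.tops-aba D a<b aba⊆r))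

descent⇒¬head0112 : ∀ {m v r} → Descent m r → v ≤ 1 + m → ¬ HeadOccurs (reverse p0112) v r
descent⇒¬head0112 D v≤ (head-occurs a<b b<c refl bba⊆r) = <⇒≱ b<c (≤-trans v≤ (Descent.tops-bba D a<b bba⊆r))

bounded⇒¬head0120 : ∀ {k v r} → All (_≤ k) r → k ≤ suc v → ¬ HeadOccurs (reverse p0120) v r
bounded⇒¬head0120 r≤k k≤ (head-occurs a<b b<c refl cba⊆r) =
  <⇒≱ (<-≤-trans (s≤s a<b) b<c) (≤-trans (head-≤ r≤k cba⊆r) k≤)

bounded⇒¬head0121 : ∀ {k v r} → All (_≤ k) r → k ≤ v → ¬ HeadOccurs (reverse p0121) v r
bounded⇒¬head0121 r≤k k≤ (head-occurs a<b b<c refl cba⊆r) = <⇒≱ b<c (≤-trans (head-≤ r≤k cba⊆r) k≤)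

Binary : List ℕ → Set
Binary r = All (_≤ 1) r × (0 ∷ 1 ∷ 0 ∷ [] ⊆ r ⊎ 1 ∷ 1 ∷ 0 ∷ [] ⊆ r)

binary-∷ : ∀ {v r} → v ≤ 1 → Binary r → Binary (v ∷ r)
binary-∷ v≤1 (r≤1 , inj₁ w) = v≤1 ∷ r≤1 , inj₁ (_ ∷ʳ w)
binary-∷ v≤1 (r≤1 , inj₂ w) = v≤1 ∷ r≤1 , inj₂ (_ ∷ʳ w)

Rising : ℕ → ℕ → List ℕ → Set
Rising k h t = h ≡ k × Staircase k (h ∷ t) × Descending (h ∷ t)

RisingPlateau : ℕ → ℕ → List ℕ → Set
RisingPlateau k h t = h ≡ k × Plateau k (h ∷ t) × Descending (h ∷ t)

rising-climb : ∀ {k h t} → Rising k h t → Rising (suc k) (suc k) (h ∷ t)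
rising-climb (refl , S , desc) =
  refl , staircase-climb S , descending-∷ (All.map m≤n⇒m≤1+n (bounded (Staircase.ladder S))) desc

rising-0 : ∀ {h t} → Rising 0 h t → Rising 0 0 (h ∷ t)
rising-0 (refl , S , desc) = refl , staircase-0 S , descending-∷ (bounded (Staircase.ladder S)) desc

steps⇒head0120 : ∀ {m v r} → Ladder (2 + m) r → v ≤ m → HeadOccurs (reverse p0120) v r
steps⇒head0120 L v≤m = cba⇒head0120 (s≤s v≤m) ≤-refl (⊆-trans (cba⊆downFrom (s≤s v≤m) ≤-refl ≤-refl) (steps L))

steps⇒head0121 : ∀ {m u r} → Ladder (2 + m) r → u ≤ m → HeadOccurs (reverse p0121) (suc u) r
steps⇒head0121 L u≤m =
  cba⇒head0121 ≤-refl (s≤s (s≤s u≤m)) (⊆-trans (cba⊆downFrom ≤-refl (s≤s (s≤s u≤m)) ≤-refl) (steps L))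

data Zone (m : ℕ) : ℕ → Set where
  low : ∀ {v} → v ≤ m → Zone m v
  prev : Zone m (1 + m)
  top : Zone m (2 + m)
  up : Zone m (3 + m)
  high : ∀ {v} → 4 + m ≤ v → Zone m v

zone : ∀ m v → Zone m v
zone zero zero = low z≤n
zone zero 1 = prev
zone zero 2 = top
zone zero 3 = up
zone zero (suc (suc (suc (suc v)))) = high (s≤s (s≤s (s≤s (s≤s z≤n))))
zone (suc m) zero = low z≤n
zone (suc m) (suc v) with zone m v
... | low v≤m = low (s≤s v≤m)
... | prev = prev
... | top = top
... | up = up
... | high 4+m≤v = high (s≤s 4+m≤v)

-- The three automata

-- 2 ^ suc n unfolds to 2 ^ n + (2 ^ n + 0).
pow+choose3-suc : ∀ n → (2 ^ n + (1 + n) C 3) + ((2 ^ n + (1 + n) C 2) + 0) ≡ 2 ^ suc n + (2 + n) C 3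
pow+choose3-suc n = begin
  (2 ^ n + (1 + n) C 3) + ((2 ^ n + (1 + n) C 2) + 0)  ≡⟨ rearrange (2 ^ n) ((1 + n) C 3) ((1 + n) C 2) ⟩
  2 ^ suc n + ((1 + n) C 2 + (1 + n) C 3)              ≡⟨ cong (2 ^ suc n +_) (nCk+nC[k+1]≡[n+1]C[k+1] (1 + n) 2) ⟩
  2 ^ suc n + (2 + n) C 3                              ∎
  where
  open ≡-Reasoning
  rearrange : ∀ p a b → (p + a) + ((p + b) + 0) ≡ (p + (p + 0)) + (b + a)
  rearrange = solve-∀

open Staircase using (ladder; repeats)

module RiseThenTail (tail-letter : ℕ → ℕ) (tail-letter< : ∀ m → tail-letter m < 2 + m) where

  -- The prefixes in each phase: zeros 0⋯0, one 0⋯0 1, binary the other 0/1-sequences (they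
  -- contain 010 or 011), rising m 0⋯0 1 2 ⋯ (m+2), plateau m a staircase followed by more
  -- letters m+2, and tail m either of these followed by letters tail-letter m.
  data Phase : Set where
    zeros one binary : Phase
    rising plateau tail : ℕ → Phase

  ≢tail-letter : ∀ {m k} → 2 + m ≤ k → k ≢ tail-letter m
  ≢tail-letter {m} 2+m≤k e = <⇒≢ (<-≤-trans (tail-letter< m) 2+m≤k) (sym e)

  next : Phase → List (ℕ × Phase)
  next zeros = (0 , zeros) ∷ (1 , one) ∷ []
  next one = (0 , binary) ∷ (1 , binary) ∷ (2 , rising 0) ∷ []
  next binary = (0 , binary) ∷ (1 , binary) ∷ []
  next (rising m) = (3 + m , rising (suc m)) ∷ (2 + m , plateau m) ∷ (tail-letter m , tail m) ∷ []
  next (plateau m) = (2 + m , plateau m) ∷ (tail-letter m , tail m) ∷ []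
  next (tail m) = (tail-letter m , tail m) ∷ []

  next-unique : ∀ s → Unique (map proj₁ (next s))
  next-unique zeros = ((λ ()) ∷ []) ∷ [] ∷ []
  next-unique one = ((λ ()) ∷ (λ ()) ∷ []) ∷ ((λ ()) ∷ []) ∷ [] ∷ []
  next-unique binary = ((λ ()) ∷ []) ∷ [] ∷ []
  next-unique (rising m) = ((λ ()) ∷ ≢tail-letter (n≤1+n _) ∷ []) ∷ (≢tail-letter ≤-refl ∷ []) ∷ [] ∷ []
  next-unique (plateau m) = (≢tail-letter ≤-refl ∷ []) ∷ [] ∷ []
  next-unique (tail m) = [] ∷ []

  open Automaton next using (count; count-suc)

  count-tail : ∀ n m → count n (tail m) ≡ 1
  count-tail zero m = refl
  count-tail (suc n) m = trans (count-suc n (tail m)) (cong (_+ 0) (count-tail n m))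

  count-plateau : ∀ n m → count n (plateau m) ≡ suc n
  count-plateau zero m = refl
  count-plateau (suc n) m rewrite count-suc n (plateau m) | count-plateau n m | count-tail n m = +-comm (suc n) 1

  count-rising : ∀ n m → count n (rising m) ≡ (2 + n) C 2
  count-rising zero m = refl
  count-rising (suc n) m rewrite count-suc n (rising m) | count-rising n (suc m) | count-plateau n m | count-tail n m = begin
    (2 + n) C 2 + (suc n + (1 + 0))  ≡⟨ rearrange ((2 + n) C 2) n ⟩
    (2 + n) + (2 + n) C 2            ≡⟨ cong (_+ (2 + n) C 2) (sym (nC1≡n (2 + n))) ⟩
    (2 + n) C 1 + (2 + n) C 2        ≡⟨ nCk+nC[k+1]≡[n+1]C[k+1] (2 + n) 1 ⟩
    (3 + n) C 2                      ∎
    where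
    open ≡-Reasoning
    rearrange : ∀ x n → x + (suc n + (1 + 0)) ≡ (2 + n) + x
    rearrange = solve-∀

  count-binary : ∀ n → count n binary ≡ 2 ^ n
  count-binary zero = refl
  count-binary (suc n) rewrite count-suc n binary | count-binary n = refl

  count-one : ∀ n → count n one ≡ 2 ^ n + (1 + n) C 2
  count-one zero = refl
  count-one (suc n) rewrite count-suc n one | count-binary n | count-rising n 0 = rearrange (2 ^ n) ((2 + n) C 2)
    where
    rearrange : ∀ p c → p + (p + (c + 0)) ≡ (p + (p + 0)) + c
    rearrange = solve-∀

  count-zeros : ∀ n → count n zeros ≡ 2 ^ n + (1 + n) C 3
  count-zeros zero = refl
  count-zeros (suc n) rewrite count-suc n zeros | count-zeros n | count-one n = pow+choose3-suc n

  module Invariant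
    (Tail : ℕ → ℕ → List ℕ → Set)
    (rising-tail : ∀ {m h t} → Rising (2 + m) h t → Tail m (tail-letter m) (h ∷ t))
    (plateau-tail : ∀ {m h t} → RisingPlateau (2 + m) h t → Tail m (tail-letter m) (h ∷ t))
    (tail-stay : ∀ m {h t} → Tail m h t → Tail m (tail-letter m) (h ∷ t))
    where

    Inv : Phase → ℕ → List ℕ → Set
    Inv zeros h t = Rising 0 h t
    Inv one h t = Rising 1 h t
    Inv binary h t = Binary (h ∷ t)
    Inv (rising m) h t = Rising (2 + m) h t
    Inv (plateau m) h t = RisingPlateau (2 + m) h t
    Inv (tail m) h t = Tail m h t

    step-invariant : ∀ {s s′ v h t} → Inv s h t → (v , s′) ∈ next s → Inv s′ v (h ∷ t)
    step-invariant {zeros} R (here refl) = rising-0 R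
    step-invariant {zeros} R (there (here refl)) = rising-climb R
    step-invariant {one} (_ , S , _) (here refl) = z≤n ∷ bounded (ladder S) , inj₁ (refl ∷ steps (ladder S))
    step-invariant {one} (_ , S , _) (there (here refl)) = ≤-refl ∷ bounded (ladder S) , inj₂ (refl ∷ steps (ladder S))
    step-invariant {one} R (there (there (here refl))) = rising-climb R
    step-invariant {binary} B (here refl) = binary-∷ z≤n B
    step-invariant {binary} B (there (here refl)) = binary-∷ ≤-refl B
    step-invariant {rising m} R (here refl) = rising-climb R
    step-invariant {rising m} (refl , S , desc) (there (here refl)) =
      refl , staircase⇒plateau S , descending-∷ (bounded (ladder S)) desc
    step-invariant {rising m} R (there (there (here refl))) = rising-tail R
    step-invariant {plateau m} (refl , P , desc) (here refl) =
      refl , plateau-stay P , descending-∷ (bounded (Plateau.ladder P)) desc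
    step-invariant {plateau m} R (there (here refl)) = plateau-tail R
    step-invariant {tail m} inv (here refl) = tail-stay m inv

    inv₀ : Inv zeros 0 []
    inv₀ = refl , staircase-[0] , descending-[x]

p0102-letters : ThreeLetterPattern p0102
p0102-letters = record
  { reduced = refl ; letters≤2 = z≤n ∷ s≤s z≤n ∷ z≤n ∷ s≤s (s≤s z≤n) ∷ []
  ; has0 = here refl ; has1 = there (here refl) ; has2 = there (there (there (here refl))) }

p0112-letters : ThreeLetterPattern p0112
p0112-letters = record
  { reduced = refl ; letters≤2 = z≤n ∷ s≤s z≤n ∷ s≤s z≤n ∷ s≤s (s≤s z≤n) ∷ []
  ; has0 = here refl ; has1 = there (here refl) ; has2 = there (there (there (here refl))) }

p0120-letters : ThreeLetterPattern p0120
p0120-letters = record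
  { reduced = refl ; letters≤2 = z≤n ∷ s≤s z≤n ∷ s≤s (s≤s z≤n) ∷ z≤n ∷ []
  ; has0 = here refl ; has1 = there (here refl) ; has2 = there (there (here refl)) }

p0121-letters : ThreeLetterPattern p0121
p0121-letters = record
  { reduced = refl ; letters≤2 = z≤n ∷ s≤s z≤n ∷ s≤s (s≤s z≤n) ∷ s≤s z≤n ∷ []
  ; has0 = here refl ; has1 = there (here refl) ; has2 = there (there (here refl)) }

P₁ : List (List ℕ)
P₁ = p0102 ∷ p0112 ∷ p0120 ∷ []

P₂ : List (List ℕ)
P₂ = p0102 ∷ p0112 ∷ p0121 ∷ []

P₃ : List (List ℕ)
P₃ = p0112 ∷ p0120 ∷ p0121 ∷ []

1+m<2+m : ∀ m → 1 + m < 2 + m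
1+m<2+m m = n<1+n (suc m)

DescentTail : ℕ → ℕ → List ℕ → Set
DescentTail m h t = h ≡ 1 + m × Descent m (h ∷ t)

rising-descentTail : ∀ {m h t} → Rising (2 + m) h t → DescentTail m (1 + m) (h ∷ t)
rising-descentTail (refl , S , desc) = refl , descent-start (ladder S) desc (inj₁ ∘ repeats S)

plateau-descentTail : ∀ {m h t} → RisingPlateau (2 + m) h t → DescentTail m (1 + m) (h ∷ t)
plateau-descentTail (refl , P , desc) = refl , descent-start (Plateau.ladder P) desc (Plateau.repeats P)

descentTail-stay : ∀ m {h t} → DescentTail m h t → DescentTail m (1 + m) (h ∷ t)
descentTail-stay _ (refl , D) = refl , descent-stay D

module Avoid0102-0112-0120 where
  open RiseThenTail suc 1+m<2+m
  open Invariant DescentTail rising-descentTail plateau-descentTail descentTail-stay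

  P-letters : All ThreeLetterPattern P₁
  P-letters = p0102-letters ∷ p0112-letters ∷ p0120-letters ∷ []

  rising-admissible : ∀ {k v h t} → Rising k h t → Admissible P₁ (h ∷ t) → v ≤ suc k → k ≤ suc v → Admissible P₁ (v ∷ h ∷ t)
  rising-admissible (_ , S , desc) adm v≤ k≤ =
    admissible-∷ adm (ladder-bound (ladder S) v≤)
      (descending⇒¬head0102 desc ∷ repeats0⇒¬head0112 (repeats S) ∷ bounded⇒¬head0120 (bounded (ladder S)) k≤ ∷ [])

  plateau-admissible : ∀ {k v h t} → Plateau k (h ∷ t) → Descending (h ∷ t) → Admissible P₁ (h ∷ t) →
                       v ≤ k → k ≤ suc v → Admissible P₁ (v ∷ h ∷ t)
  plateau-admissible P desc adm v≤ k≤ =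
    admissible-∷ adm (ladder-bound (Plateau.ladder P) (m≤n⇒m≤1+n v≤))
      (descending⇒¬head0102 desc ∷ plateau⇒¬head0112 (Plateau.repeats P) v≤ ∷ bounded⇒¬head0120 (bounded (Plateau.ladder P)) k≤ ∷ [])

  step-admissible : ∀ {s s′ v h t} → Inv s h t → Admissible P₁ (h ∷ t) → (v , s′) ∈ next s → Admissible P₁ (v ∷ h ∷ t)
  step-admissible {zeros} (_ , S , _) adm (here refl) = binary-step P-letters z≤n (All.map m≤n⇒m≤1+n (bounded (ladder S))) adm
  step-admissible {zeros} (_ , S , _) adm (there (here refl)) = binary-step P-letters ≤-refl (All.map m≤n⇒m≤1+n (bounded (ladder S))) adm
  step-admissible {one} (_ , S , _) adm (here refl) = binary-step P-letters z≤n (bounded (ladder S)) adm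
  step-admissible {one} (_ , S , _) adm (there (here refl)) = binary-step P-letters ≤-refl (bounded (ladder S)) adm
  step-admissible {one} R adm (there (there (here refl))) = rising-admissible R adm ≤-refl (s≤s z≤n)
  step-admissible {binary} (r≤1 , _) adm (here refl) = binary-step P-letters z≤n r≤1 adm
  step-admissible {binary} (r≤1 , _) adm (there (here refl)) = binary-step P-letters ≤-refl r≤1 adm
  step-admissible {rising m} R adm (here refl) = rising-admissible R adm ≤-refl (≤-trans (n≤1+n _) (n≤1+n _))
  step-admissible {rising m} R adm (there (here refl)) = rising-admissible R adm (n≤1+n _) (n≤1+n _)
  step-admissible {rising m} R adm (there (there (here refl))) = rising-admissible R adm (≤-trans (n≤1+n _) (n≤1+n _)) ≤-refl
  step-admissible {plateau m} (refl , P , desc) adm (here refl) = plateau-admissible P desc adm ≤-refl (n≤1+n _)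
  step-admissible {plateau m} (refl , P , desc) adm (there (here refl)) = plateau-admissible P desc adm (n≤1+n _) ≤-refl
  step-admissible {tail m} (refl , D) adm (here refl) =
    admissible-∷ adm (ladder-bound (Descent.ladder D) (≤-trans (n≤1+n _) (n≤1+n _)))
      (descent⇒¬head0102 D ≤-refl ∷ descent⇒¬head0112 D ≤-refl ∷ bounded⇒¬head0120 (bounded (Descent.ladder D)) ≤-refl ∷ [])

  step-complete : ∀ {s v h t} → Inv s h t → Admissible P₁ (v ∷ h ∷ t) → ∃[ s′ ] (v , s′) ∈ next s
  step-complete {zeros} {0} _ _ = _ , here refl
  step-complete {zeros} {1} _ _ = _ , there (here refl)
  step-complete {zeros} {suc (suc v)} (_ , S , _) (asc , _) = ⊥-elim (ladder-too-high (ladder S) (s≤s (s≤s z≤n)) asc)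
  step-complete {one} {0} _ _ = _ , here refl
  step-complete {one} {1} _ _ = _ , there (here refl)
  step-complete {one} {2} _ _ = _ , there (there (here refl))
  step-complete {one} {suc (suc (suc v))} (_ , S , _) (asc , _) = ⊥-elim (ladder-too-high (ladder S) (s≤s (s≤s (s≤s z≤n))) asc)
  step-complete {binary} {0} _ _ = _ , here refl
  step-complete {binary} {1} _ _ = _ , there (here refl)
  step-complete {binary} {suc (suc v)} (_ , inj₁ w) (_ , ¬0102 ∷ _) = contradiction (aba⇒head0102 (s≤s z≤n) (s≤s (s≤s z≤n)) w) (¬head ¬0102)
  step-complete {binary} {suc (suc v)} (_ , inj₂ w) (_ , _ ∷ ¬0112 ∷ _) = contradiction (bba⇒head0112 (s≤s z≤n) (s≤s (s≤s z≤n)) w) (¬head ¬0112)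
  step-complete {rising m} {v} (refl , S , _) (asc , _ ∷ _ ∷ ¬0120 ∷ []) with zone m v
  ... | low v≤m = contradiction (steps⇒head0120 (ladder S) v≤m) (¬head ¬0120)
  ... | prev = _ , there (there (here refl))
  ... | top = _ , there (here refl)
  ... | up = _ , here refl
  ... | high 4+m≤v = ⊥-elim (ladder-too-high (ladder S) 4+m≤v asc)
  step-complete {plateau m} {v} (refl , P , _) (_ , _ ∷ ¬0112 ∷ ¬0120 ∷ []) with zone m v
  ... | low v≤m = contradiction (steps⇒head0120 (Plateau.ladder P) v≤m) (¬head ¬0120)
  ... | prev = _ , there (here refl)
  ... | top = _ , here refl
  ... | up = contradiction (bba⇒head0112 ≤-refl ≤-refl (Plateau.doubled P)) (¬head ¬0112)
  ... | high 4+m≤v = contradiction (bba⇒head0112 ≤-refl (≤-trans (n≤1+n _) 4+m≤v) (Plateau.doubled P)) (¬head ¬0112)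
  step-complete {tail m} {v} (refl , D) (_ , ¬0102 ∷ ¬0112 ∷ ¬0120 ∷ []) with zone m v
  ... | low v≤m = contradiction (steps⇒head0120 (Descent.ladder D) v≤m) (¬head ¬0120)
  ... | prev = _ , here refl
  ... | top = contradiction (bba⇒head0112 ≤-refl ≤-refl (Descent.doubled D)) (¬head ¬0112)
  ... | up = contradiction (aba⇒head0102 ≤-refl ≤-refl (Descent.peak D)) (¬head ¬0102)
  ... | high 4+m≤v = contradiction (aba⇒head0102 ≤-refl (≤-trans (n≤1+n _) 4+m≤v) (Descent.peak D)) (¬head ¬0102)

  open Recognition P-letters next next-unique Inv step-invariant step-admissible step-complete zeros inv₀

  𝒜↔ : ∀ n → Fin (2 ^ n + suc n C 3) ↔ 𝒜 (suc n) P₁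
  𝒜↔ n = subst (λ k → Fin k ↔ 𝒜 (suc n) P₁) (count-zeros n) (count↔𝒜 n)

ZeroTail : ℕ → ℕ → List ℕ → Set
ZeroTail _ h t = 0 ∷ 1 ∷ 0 ∷ [] ⊆ h ∷ t × 2 ∷ 1 ∷ 0 ∷ [] ⊆ h ∷ t

ladder⇒zeroTail : ∀ {m h t} → Ladder (2 + m) (h ∷ t) → ZeroTail m 0 (h ∷ t)
ladder⇒zeroTail L =
  refl ∷ ⊆-trans (ba⊆downFrom (s≤s z≤n) (s≤s (s≤s z≤n))) (steps L) ,
  0 ∷ʳ ⊆-trans (cba⊆downFrom (s≤s z≤n) (s≤s (s≤s z≤n)) (s≤s (s≤s (s≤s z≤n)))) (steps L)

rising-zeroTail : ∀ {m h t} → Rising (2 + m) h t → ZeroTail m 0 (h ∷ t)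
rising-zeroTail (_ , S , _) = ladder⇒zeroTail (ladder S)

plateau-zeroTail : ∀ {m h t} → RisingPlateau (2 + m) h t → ZeroTail m 0 (h ∷ t)
plateau-zeroTail (_ , P , _) = ladder⇒zeroTail (Plateau.ladder P)

zeroTail-stay : ∀ m {h t} → ZeroTail m h t → ZeroTail m 0 (h ∷ t)
zeroTail-stay _ (w010 , w210) = 0 ∷ʳ w010 , 0 ∷ʳ w210

0<2+m : ∀ m → 0 < 2 + m
0<2+m _ = s≤s z≤n

module Avoid0102-0112-0121 where
  open RiseThenTail (const 0) 0<2+m
  open Invariant ZeroTail rising-zeroTail plateau-zeroTail zeroTail-stay

  P-letters : All ThreeLetterPattern P₂
  P-letters = p0102-letters ∷ p0112-letters ∷ p0121-letters ∷ []

  rising-admissible : ∀ {k v h t} → Rising k h t → Admissible P₂ (h ∷ t) → v ≤ suc k → k ≤ v → Admissible P₂ (v ∷ h ∷ t)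
  rising-admissible (_ , S , desc) adm v≤ k≤ =
    admissible-∷ adm (ladder-bound (ladder S) v≤)
      (descending⇒¬head0102 desc ∷ repeats0⇒¬head0112 (repeats S) ∷ bounded⇒¬head0121 (bounded (ladder S)) k≤ ∷ [])

  zero-admissible : ∀ {h t} → Admissible P₂ (h ∷ t) → Admissible P₂ (0 ∷ h ∷ t)
  zero-admissible adm = admissible-∷ adm z≤n (¬head-0 ∷ ¬head-0 ∷ ¬head-0 ∷ [])

  step-admissible : ∀ {s s′ v h t} → Inv s h t → Admissible P₂ (h ∷ t) → (v , s′) ∈ next s → Admissible P₂ (v ∷ h ∷ t)
  step-admissible {zeros} (_ , S , _) adm (here refl) = binary-step P-letters z≤n (All.map m≤n⇒m≤1+n (bounded (ladder S))) adm
  step-admissible {zeros} (_ , S , _) adm (there (here refl)) = binary-step P-letters ≤-refl (All.map m≤n⇒m≤1+n (bounded (ladder S))) adm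
  step-admissible {one} (_ , S , _) adm (here refl) = binary-step P-letters z≤n (bounded (ladder S)) adm
  step-admissible {one} (_ , S , _) adm (there (here refl)) = binary-step P-letters ≤-refl (bounded (ladder S)) adm
  step-admissible {one} R adm (there (there (here refl))) = rising-admissible R adm ≤-refl (s≤s z≤n)
  step-admissible {binary} (r≤1 , _) adm (here refl) = binary-step P-letters z≤n r≤1 adm
  step-admissible {binary} (r≤1 , _) adm (there (here refl)) = binary-step P-letters ≤-refl r≤1 adm
  step-admissible {rising m} R adm (here refl) = rising-admissible R adm ≤-refl (n≤1+n _)
  step-admissible {rising m} R adm (there (here refl)) = rising-admissible R adm (n≤1+n _) ≤-refl
  step-admissible {rising m} R adm (there (there (here refl))) = zero-admissible adm
  step-admissible {plateau m} (refl , P , desc) adm (here refl) =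
    admissible-∷ adm (ladder-bound (Plateau.ladder P) (n≤1+n _))
      (descending⇒¬head0102 desc ∷ plateau⇒¬head0112 (Plateau.repeats P) ≤-refl ∷ bounded⇒¬head0121 (bounded (Plateau.ladder P)) ≤-refl ∷ [])
  step-admissible {plateau m} R adm (there (here refl)) = zero-admissible adm
  step-admissible {tail m} F adm (here refl) = zero-admissible adm

  step-complete : ∀ {s v h t} → Inv s h t → Admissible P₂ (v ∷ h ∷ t) → ∃[ s′ ] (v , s′) ∈ next s
  step-complete {zeros} {0} _ _ = _ , here refl
  step-complete {zeros} {1} _ _ = _ , there (here refl)
  step-complete {zeros} {suc (suc v)} (_ , S , _) (asc , _) = ⊥-elim (ladder-too-high (ladder S) (s≤s (s≤s z≤n)) asc)
  step-complete {one} {0} _ _ = _ , here refl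
  step-complete {one} {1} _ _ = _ , there (here refl)
  step-complete {one} {2} _ _ = _ , there (there (here refl))
  step-complete {one} {suc (suc (suc v))} (_ , S , _) (asc , _) = ⊥-elim (ladder-too-high (ladder S) (s≤s (s≤s (s≤s z≤n))) asc)
  step-complete {binary} {0} _ _ = _ , here refl
  step-complete {binary} {1} _ _ = _ , there (here refl)
  step-complete {binary} {suc (suc v)} (_ , inj₁ w) (_ , ¬0102 ∷ _) = contradiction (aba⇒head0102 (s≤s z≤n) (s≤s (s≤s z≤n)) w) (¬head ¬0102)
  step-complete {binary} {suc (suc v)} (_ , inj₂ w) (_ , _ ∷ ¬0112 ∷ _) = contradiction (bba⇒head0112 (s≤s z≤n) (s≤s (s≤s z≤n)) w) (¬head ¬0112)
  step-complete {rising m} {v} (refl , S , _) (asc , _ ∷ _ ∷ ¬0121 ∷ []) with zone m v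
  ... | low {0} _ = _ , there (there (here refl))
  ... | low {suc u} u<m = contradiction (steps⇒head0121 (ladder S) (<⇒≤ u<m)) (¬head ¬0121)
  ... | prev = contradiction (steps⇒head0121 (ladder S) ≤-refl) (¬head ¬0121)
  ... | top = _ , there (here refl)
  ... | up = _ , here refl
  ... | high 4+m≤v = ⊥-elim (ladder-too-high (ladder S) 4+m≤v asc)
  step-complete {plateau m} {v} (refl , P , _) (_ , _ ∷ ¬0112 ∷ ¬0121 ∷ []) with zone m v
  ... | low {0} _ = _ , there (here refl)
  ... | low {suc u} u<m = contradiction (steps⇒head0121 (Plateau.ladder P) (<⇒≤ u<m)) (¬head ¬0121)
  ... | prev = contradiction (steps⇒head0121 (Plateau.ladder P) ≤-refl) (¬head ¬0121)
  ... | top = _ , here refl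
  ... | up = contradiction (bba⇒head0112 ≤-refl ≤-refl (Plateau.doubled P)) (¬head ¬0112)
  ... | high 4+m≤v = contradiction (bba⇒head0112 ≤-refl (≤-trans (n≤1+n _) 4+m≤v) (Plateau.doubled P)) (¬head ¬0112)
  step-complete {tail m} {0} _ _ = _ , here refl
  step-complete {tail m} {1} (_ , w210) (_ , _ ∷ _ ∷ ¬0121 ∷ []) = contradiction (cba⇒head0121 (s≤s z≤n) (s≤s (s≤s z≤n)) w210) (¬head ¬0121)
  step-complete {tail m} {suc (suc v)} (w010 , _) (_ , ¬0102 ∷ _) = contradiction (aba⇒head0102 (s≤s z≤n) (s≤s (s≤s z≤n)) w010) (¬head ¬0102)

  open Recognition P-letters next next-unique Inv step-invariant step-admissible step-complete zeros inv₀

  𝒜↔ : ∀ n → Fin (2 ^ n + suc n C 3) ↔ 𝒜 (suc n) P₂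
  𝒜↔ n = subst (λ k → Fin k ↔ 𝒜 (suc n) P₂) (count-zeros n) (count↔𝒜 n)

module Avoid0112-0120-0121 where

  -- Here one is 0⋯0 1 0⋯0, binary contains 011 and rising m is 0⋯0 1 0⋯0 2 3 ⋯ (m+2).
  data Phase : Set where
    zeros one binary : Phase
    rising plateau : ℕ → Phase

  next : Phase → List (ℕ × Phase)
  next zeros = (0 , zeros) ∷ (1 , one) ∷ []
  next one = (0 , one) ∷ (1 , binary) ∷ (2 , rising 0) ∷ []
  next binary = (0 , binary) ∷ (1 , binary) ∷ []
  next (rising m) = (3 + m , rising (suc m)) ∷ (2 + m , plateau m) ∷ []
  next (plateau m) = (2 + m , plateau m) ∷ []

  next-unique : ∀ s → Unique (map proj₁ (next s))
  next-unique zeros = ((λ ()) ∷ []) ∷ [] ∷ []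
  next-unique one = ((λ ()) ∷ (λ ()) ∷ []) ∷ ((λ ()) ∷ []) ∷ [] ∷ []
  next-unique binary = ((λ ()) ∷ []) ∷ [] ∷ []
  next-unique (rising m) = ((λ ()) ∷ []) ∷ [] ∷ []
  next-unique (plateau m) = [] ∷ []

  open Automaton next using (count; count-suc)

  count-plateau : ∀ n m → count n (plateau m) ≡ 1
  count-plateau zero m = refl
  count-plateau (suc n) m rewrite count-suc n (plateau m) | count-plateau n m = refl

  count-rising : ∀ n m → count n (rising m) ≡ suc n
  count-rising zero m = refl
  count-rising (suc n) m rewrite count-suc n (rising m) | count-rising n (suc m) | count-plateau n m = rearrange n
    where
    rearrange : ∀ n → suc n + (1 + 0) ≡ suc (suc n)
    rearrange = solve-∀

  count-binary : ∀ n → count n binary ≡ 2 ^ n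
  count-binary zero = refl
  count-binary (suc n) rewrite count-suc n binary | count-binary n = refl

  count-one : ∀ n → count n one ≡ 2 ^ n + (1 + n) C 2
  count-one zero = refl
  count-one (suc n) rewrite count-suc n one | count-one n | count-binary n | count-rising n 0 = begin
    (2 ^ n + (1 + n) C 2) + (2 ^ n + (suc n + 0))  ≡⟨ rearrange (2 ^ n) ((1 + n) C 2) n ⟩
    2 ^ suc n + (suc n + (1 + n) C 2)              ≡⟨ cong (λ k → 2 ^ suc n + (k + (1 + n) C 2)) (sym (nC1≡n (1 + n))) ⟩
    2 ^ suc n + ((1 + n) C 1 + (1 + n) C 2)        ≡⟨ cong (2 ^ suc n +_) (nCk+nC[k+1]≡[n+1]C[k+1] (1 + n) 1) ⟩
    2 ^ suc n + (2 + n) C 2                        ∎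
    where
    open ≡-Reasoning
    rearrange : ∀ p c n → (p + c) + (p + (suc n + 0)) ≡ (p + (p + 0)) + (suc n + c)
    rearrange = solve-∀

  count-zeros : ∀ n → count n zeros ≡ 2 ^ n + (1 + n) C 3
  count-zeros zero = refl
  count-zeros (suc n) rewrite count-suc n zeros | count-zeros n | count-one n = pow+choose3-suc n

  Inv : Phase → ℕ → List ℕ → Set
  Inv zeros h t = Staircase 0 (h ∷ t)
  Inv one h t = Staircase 1 (h ∷ t)
  Inv binary h t = All (_≤ 1) (h ∷ t) × 1 ∷ 1 ∷ 0 ∷ [] ⊆ h ∷ t
  Inv (rising m) h t = h ≡ 2 + m × Staircase (2 + m) (h ∷ t)
  Inv (plateau m) h t = h ≡ 2 + m × Plateau (2 + m) (h ∷ t)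

  step-invariant : ∀ {s s′ v h t} → Inv s h t → (v , s′) ∈ next s → Inv s′ v (h ∷ t)
  step-invariant {zeros} S (here refl) = staircase-0 S
  step-invariant {zeros} S (there (here refl)) = staircase-climb S
  step-invariant {one} S (here refl) = staircase-0 S
  step-invariant {one} S (there (here refl)) = ≤-refl ∷ bounded (ladder S) , refl ∷ steps (ladder S)
  step-invariant {one} S (there (there (here refl))) = refl , staircase-climb S
  step-invariant {binary} (r≤1 , w) (here refl) = z≤n ∷ r≤1 , _ ∷ʳ w
  step-invariant {binary} (r≤1 , w) (there (here refl)) = ≤-refl ∷ r≤1 , _ ∷ʳ w
  step-invariant {rising m} (refl , S) (here refl) = refl , staircase-climb S
  step-invariant {rising m} (refl , S) (there (here refl)) = refl , staircase⇒plateau S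
  step-invariant {plateau m} (refl , P) (here refl) = refl , plateau-stay P

  P-letters : All ThreeLetterPattern P₃
  P-letters = p0112-letters ∷ p0120-letters ∷ p0121-letters ∷ []

  staircase-admissible : ∀ {k v h t} → Staircase k (h ∷ t) → Admissible P₃ (h ∷ t) → v ≤ suc k → k ≤ v → Admissible P₃ (v ∷ h ∷ t)
  staircase-admissible S adm v≤ k≤ =
    admissible-∷ adm (ladder-bound (ladder S) v≤)
      (repeats0⇒¬head0112 (repeats S) ∷ bounded⇒¬head0120 (bounded (ladder S)) (m≤n⇒m≤1+n k≤) ∷ bounded⇒¬head0121 (bounded (ladder S)) k≤ ∷ [])

  step-admissible : ∀ {s s′ v h t} → Inv s h t → Admissible P₃ (h ∷ t) → (v , s′) ∈ next s → Admissible P₃ (v ∷ h ∷ t)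
  step-admissible {zeros} S adm (here refl) = binary-step P-letters z≤n (All.map m≤n⇒m≤1+n (bounded (ladder S))) adm
  step-admissible {zeros} S adm (there (here refl)) = binary-step P-letters ≤-refl (All.map m≤n⇒m≤1+n (bounded (ladder S))) adm
  step-admissible {one} S adm (here refl) = binary-step P-letters z≤n (bounded (ladder S)) adm
  step-admissible {one} S adm (there (here refl)) = binary-step P-letters ≤-refl (bounded (ladder S)) adm
  step-admissible {one} S adm (there (there (here refl))) = staircase-admissible S adm ≤-refl (s≤s z≤n)
  step-admissible {binary} (r≤1 , _) adm (here refl) = binary-step P-letters z≤n r≤1 adm
  step-admissible {binary} (r≤1 , _) adm (there (here refl)) = binary-step P-letters ≤-refl r≤1 adm
  step-admissible {rising m} (refl , S) adm (here refl) = staircase-admissible S adm ≤-refl (n≤1+n _)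
  step-admissible {rising m} (refl , S) adm (there (here refl)) = staircase-admissible S adm (n≤1+n _) ≤-refl
  step-admissible {plateau m} (refl , P) adm (here refl) =
    admissible-∷ adm (ladder-bound (Plateau.ladder P) (n≤1+n _))
      (plateau⇒¬head0112 (Plateau.repeats P) ≤-refl ∷ bounded⇒¬head0120 (bounded (Plateau.ladder P)) (n≤1+n _)
        ∷ bounded⇒¬head0121 (bounded (Plateau.ladder P)) ≤-refl ∷ [])

  step-complete : ∀ {s v h t} → Inv s h t → Admissible P₃ (v ∷ h ∷ t) → ∃[ s′ ] (v , s′) ∈ next s
  step-complete {zeros} {0} _ _ = _ , here refl
  step-complete {zeros} {1} _ _ = _ , there (here refl)
  step-complete {zeros} {suc (suc v)} S (asc , _) = ⊥-elim (ladder-too-high (ladder S) (s≤s (s≤s z≤n)) asc)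
  step-complete {one} {0} _ _ = _ , here refl
  step-complete {one} {1} _ _ = _ , there (here refl)
  step-complete {one} {2} _ _ = _ , there (there (here refl))
  step-complete {one} {suc (suc (suc v))} S (asc , _) = ⊥-elim (ladder-too-high (ladder S) (s≤s (s≤s (s≤s z≤n))) asc)
  step-complete {binary} {0} _ _ = _ , here refl
  step-complete {binary} {1} _ _ = _ , there (here refl)
  step-complete {binary} {suc (suc v)} (_ , w) (_ , ¬0112 ∷ _) = contradiction (bba⇒head0112 (s≤s z≤n) (s≤s (s≤s z≤n)) w) (¬head ¬0112)
  step-complete {rising m} {v} (refl , S) (asc , _ ∷ ¬0120 ∷ ¬0121 ∷ []) with zone m v
  ... | low v≤m = contradiction (steps⇒head0120 (ladder S) v≤m) (¬head ¬0120)
  ... | prev = contradiction (steps⇒head0121 (ladder S) ≤-refl) (¬head ¬0121)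
  ... | top = _ , there (here refl)
  ... | up = _ , here refl
  ... | high 4+m≤v = ⊥-elim (ladder-too-high (ladder S) 4+m≤v asc)
  step-complete {plateau m} {v} (refl , P) (_ , ¬0112 ∷ ¬0120 ∷ ¬0121 ∷ []) with zone m v
  ... | low v≤m = contradiction (steps⇒head0120 (Plateau.ladder P) v≤m) (¬head ¬0120)
  ... | prev = contradiction (steps⇒head0121 (Plateau.ladder P) ≤-refl) (¬head ¬0121)
  ... | top = _ , here refl
  ... | up = contradiction (bba⇒head0112 ≤-refl ≤-refl (Plateau.doubled P)) (¬head ¬0112)
  ... | high 4+m≤v = contradiction (bba⇒head0112 ≤-refl (≤-trans (n≤1+n _) 4+m≤v) (Plateau.doubled P)) (¬head ¬0112)

  open Recognition P-letters next next-unique Inv step-invariant step-admissible step-complete zeros staircase-[0]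

  𝒜↔ : ∀ n → Fin (2 ^ n + suc n C 3) ↔ 𝒜 (suc n) P₃
  𝒜↔ n = subst (λ k → Fin k ↔ 𝒜 (suc n) P₃) (count-zeros n) (count↔𝒜 n)

theorem4p2 : (n : ℕ) → 1 ≤ n →
    (Fin (2 ^ (n ∸ 1) + n C 3) ↔ 𝒜 n (p0102 ∷ p0112 ∷ p0120 ∷ []))
    × (Fin (2 ^ (n ∸ 1) + n C 3) ↔ 𝒜 n (p0102 ∷ p0112 ∷ p0121 ∷ []))
    × (Fin (2 ^ (n ∸ 1) + n C 3) ↔ 𝒜 n (p0112 ∷ p0120 ∷ p0121 ∷ []))
theorem4p2 (suc n) _ = Avoid0102-0112-0120.𝒜↔ n , Avoid0102-0112-0121.𝒜↔ n , Avoid0112-0120-0121.𝒜↔ n
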